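{- For trees $T_1$ and $T_2$, $\pi_{T_1}^{(P_2)}=\pi_{T_2}^{(P_2)}$ (as functions of $k\in\mathbb{N}$) if and only if $T_1$ and $T_2$ have the same degree sequence.
   Context: For a finite simple graph $G$ and $k\in\mathbb{N}$, the $k$-coloring graph $\mathcal{C}_k(G)$ has as vertices the proper colorings $V(G)\to\{1,\dots,k\}$, two colorings adjacent iff they differ on exactly one vertex of $G$. The chromatic pairs polynomial $\pi_G^{(P_2)}(k)$ is the number of edges of $\mathcal{C}_k(G)$ (equivalently, the number of induced copies of the one-edge graph $P_2$ in $\mathcal{C}_k(G)$). -}

module Defs where

open import Data.Nat using (ℕ; zero; suc; _+_; _≤_; _/_)
open import Data.Bool using (Bool; true; false; not; _∧_; if_then_else_)
open import Data.Fin using (Fin)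
open import Data.Fin.Properties using () renaming (_≟_ to _≟ᶠ_)
open import Data.List using (List; []; _∷_; map; length; filter; allFin; concatMap; last)
open import Data.List.Relation.Unary.Unique.Propositional using (Unique)
open import Data.List.Relation.Unary.Linked using (Linked)
open import Data.Maybe using (just)
open import Data.Product using (Σ; _×_; _,_)
open import Data.Vec using (Vec; []; _∷_; toList; zipWith)
open import Relation.Binary.PropositionalEquality using (_≡_)
open import Relation.Nullary using (¬_; does; Dec)
open import Data.Empty using (⊥)
import Data.Bool

record Graph (n : ℕ) : Set where
  field
    adj     : Fin n → Fin n → Bool
    symm    : ∀ u v → adj u v ≡ adj v u
    irrefl  : ∀ v → adj v v ≡ false
open Graph public

Adj : ∀ {n} → Graph n → Fin n → Fin n → Set
Adj G u v = adj G u v ≡ true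

data Walk {n : ℕ} (G : Graph n) : Fin n → Fin n → Set where
  [] : ∀ {v} → Walk G v v
  _∷_ : ∀ {u w v} → Adj G u w → Walk G w v → Walk G u v

Connected : ∀ {n} → Graph n → Set
Connected G = ∀ u v → Walk G u v

IsCycle : ∀ {n} → Graph n → List (Fin n) → Set
IsCycle G [] = ⊥
IsCycle G (v ∷ vs) =
  (3 ≤ suc (length vs)) × Unique (v ∷ vs) × Linked (Adj G) (v ∷ vs)
  × Σ (Fin _) (λ w → (last (v ∷ vs) ≡ just w) × Adj G w v)

Acyclic : ∀ {n} → Graph n → Set
Acyclic G = ∀ cs → ¬ IsCycle G cs

IsTree : ∀ {n} → Graph n → Set
IsTree {n} G = (1 ≤ n) × Connected G × Acyclic G

-- Degree of a vertex and the degree sequence (as a list; compared up to permutation).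
degree : ∀ {n} → Graph n → Fin n → ℕ
degree {n} G v = length (filter (λ u → Data.Bool._≟_ (adj G v u) true) (allFin n))

degreeList : ∀ {n} → Graph n → List ℕ
degreeList {n} G = map (degree G) (allFin n)

-- All maps Fin n → Fin k, represented as vectors.
allVecs : (k n : ℕ) → List (Vec (Fin k) n)
allVecs k zero = [] ∷ []
allVecs k (suc n) = concatMap (λ c → map (c ∷_) (allVecs k n)) (allFin k)

lookupV : ∀ {k n} → Vec (Fin k) n → Fin n → Fin k
lookupV = Data.Vec.lookup
  where import Data.Vec

eqF : ∀ {k} → Fin k → Fin k → Bool
eqF a b = does (a ≟ᶠ b)

allB : ∀ {A : Set} → (A → Bool) → List A → Bool
allB p [] = true
allB p (x ∷ xs) = p x ∧ allB p xs

isProper : ∀ {n k} → Graph n → Vec (Fin k) n → Bool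
isProper {n} G c =
  allB (λ u → allB (λ v → not (adj G u v ∧ eqF (lookupV c u) (lookupV c v))) (allFin n)) (allFin n)

properColorings : ∀ {n} → Graph n → (k : ℕ) → List (Vec (Fin k) n)
properColorings {n} G k = filter (λ c → Data.Bool._≟_ (isProper G c) true) (allVecs k n)

hamming : ∀ {k n} → Vec (Fin k) n → Vec (Fin k) n → ℕ
hamming [] [] = 0
hamming (a ∷ as) (b ∷ bs) = (if eqF a b then 0 else 1) + hamming as bs

orderedAdjPairs : ∀ {n} → Graph n → ℕ → ℕ
orderedAdjPairs G k =
  length (filter (λ p → Data.Nat._≟_ (hamming (Data.Product.proj₁ p) (Data.Product.proj₂ p)) 1)
    (Data.List.cartesianProduct (properColorings G k) (properColorings G k)))
  where import Data.Nat; import Data.List; import Data.Product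

-- Chromatic pairs polynomial: number of edges of the k-coloring graph C_k(G)
-- (each edge counted once, i.e. ordered pairs divided by 2).
chromaticPairs : ∀ {n} → Graph n → ℕ → ℕ
chromaticPairs G k = orderedAdjPairs G k / 2

-- Count the ordered pairs of proper k-colorings of a tree that differ exactly at a vertex v of
-- degree d. Growing the tree from one vertex by attaching leaves shows that there are
-- k(k − 1)·(k − 1)^(n−1−d)·(k − 2)^d of them: a new leaf multiplies the count at a vertex other than
-- its parent by k − 1 (the leaf avoids the parent's color), the count at its parent by k − 2 (the
-- leaf avoids the parent's old and new colors), and itself contributes (k − 1)(k − 2) times the
-- k(k − 1)^(n−2) colorings of the rest. Hence
--   π(k) = C(k,2) · Σ_v (k − 1)^(n−1−d_v) · (k − 2)^(d_v)
-- depends only on the degree sequence. Conversely, at k = x + 2 the sum Σ_v (x + 1)^(n−1−d_v) · x^(d_v)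
-- grows like x^(n−1), which determines n; modulo a large x it counts the zero degrees, and removing
-- these and dividing by x leaves the same sum for the other degrees lowered by one, so by induction
-- every multiplicity in the degree sequence is determined.

module Submission where

open import Data.Bool using (Bool; true; false; not; _∧_; if_then_else_)
import Data.Bool as Bool
open import Data.Bool.Properties using (∧-conicalˡ; ∧-conicalʳ; ⇔→≡)
open import Data.Empty using (⊥-elim)
open import Data.Fin using (Fin; zero; suc; punchIn; punchOut)
import Data.Fin.Properties as Fin
open import Data.List using (List; []; _∷_; map; length; filter; allFin; concatMap; _++_; tabulate; cartesianProduct; replicate; last)
import Data.List.Properties as List
open import Data.List.Membership.Propositional using (_∈_)
open import Data.List.Relation.Binary.Permutation.Propositional
  using (_↭_; ↭-refl; ↭-sym; ↭-trans; prep; module PermutationReasoning)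
import Data.List.Relation.Binary.Permutation.Propositional.Properties as Perm
open import Data.List.Relation.Unary.All using (All; []; _∷_)
import Data.List.Relation.Unary.All.Properties as All
open import Data.List.Relation.Unary.AllPairs using ([]; _∷_)
open import Data.List.Relation.Unary.Any using (here; there)
open import Data.List.Relation.Unary.Linked using (Linked; []; [-]; _∷_)
import Data.List.Relation.Unary.Linked.Properties as Linked
open import Data.List.Relation.Unary.Unique.Propositional using (Unique)
import Data.List.Relation.Unary.Unique.Propositional.Properties as Unique
open import Data.Maybe using (just)
import Data.Maybe as Maybe
open import Data.Nat using (ℕ; zero; suc; _+_; _*_; _∸_; _^_; _/_; _≤_; _<_; _≡ᵇ_; z≤n; s≤s; s≤s⁻¹)
import Data.Nat as ℕ
open import Data.Nat.Combinatorics using (_C_; nC1≡n; nCk+nC[k+1]≡[n+1]C[k+1])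
open import Data.Nat.DivMod using (_%_; m*n/n≡m; m<n⇒m%n≡m; [m+kn]%n≡m%n)
open import Data.Nat.ListAction using (sum)
open import Data.Nat.ListAction.Properties using (sum-↭)
open import Data.Nat.Properties
open import Algebra.Properties.CommutativeSemigroup +-commutativeSemigroup using (interchange; x∙yz≈y∙xz)
open import Algebra.Properties.CommutativeSemigroup *-commutativeSemigroup
  using () renaming (x∙yz≈y∙xz to x*[y*z]≡y*[x*z]; xy∙z≈xz∙y to x*y*z≡x*z*y)
open import Data.Nat.Tactic.RingSolver using (solve-∀)
open import Data.Product using (_×_; _,_; proj₁; proj₂; Σ; ∃)
open import Data.Vec using (Vec; []; _∷_; lookup; insertAt; _[_]≔_)
import Data.Vec.Properties as Vec
open import Defs
open import Function using (_∘_; id; _⇔_; mk⇔; Equivalence; case_of_)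
open import Relation.Binary.Definitions using (tri<; tri≈; tri>)
open import Relation.Binary.PropositionalEquality
open import Relation.Nullary using (does; yes; no; ¬_)
open import Relation.Nullary.Decidable using (dec-true; dec-false; does-⇔; _×-dec_; ¬?)
open import Relation.Unary using (Decidable)

open Equivalence using (to; from)

⟦_⟧ : Bool → ℕ
⟦ true ⟧  = 1
⟦ false ⟧ = 0

⟦∧⟧ : ∀ a b → ⟦ a ∧ b ⟧ ≡ ⟦ a ⟧ * ⟦ b ⟧
⟦∧⟧ true  b = sym (+-identityʳ ⟦ b ⟧)
⟦∧⟧ false b = refl

⟦⟧-idem : ∀ b → ⟦ b ⟧ * ⟦ b ⟧ ≡ ⟦ b ⟧
⟦⟧-idem true  = refl
⟦⟧-idem false = refl

⟦⟧≤1 : ∀ b → ⟦ b ⟧ ≤ 1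
⟦⟧≤1 true  = ≤-refl
⟦⟧≤1 false = z≤n

does-≟-true : ∀ b → does (b Bool.≟ true) ≡ b
does-≟-true true  = refl
does-≟-true false = refl

∑ : {A : Set} → List A → (A → ℕ) → ℕ
∑ xs f = sum (map f xs)

-- Binds tighter than _+_ and looser than _*_: ∑[ x ∈ xs ] f x * g x + c is (∑[ x ∈ xs ] (f x * g x)) + c.
infix 6.5 ∑

syntax ∑ xs (λ x → e) = ∑[ x ∈ xs ] e

module _ {A : Set} where

  ∑-cong : ∀ xs {f g : A → ℕ} → (∀ x → f x ≡ g x) → ∑ xs f ≡ ∑ xs g
  ∑-cong []       f≗g = refl
  ∑-cong (x ∷ xs) f≗g = cong₂ _+_ (f≗g x) (∑-cong xs f≗g)

  ∑-++ : ∀ xs ys (f : A → ℕ) → ∑ (xs ++ ys) f ≡ ∑ xs f + ∑ ys f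
  ∑-++ []       ys f = refl
  ∑-++ (x ∷ xs) ys f = trans (cong (f x +_) (∑-++ xs ys f)) (sym (+-assoc (f x) _ _))

  ∑-zero : ∀ (xs : List A) → ∑[ x ∈ xs ] 0 ≡ 0
  ∑-zero []       = refl
  ∑-zero (x ∷ xs) = ∑-zero xs

  ∑-distrib-+ : ∀ xs (f g : A → ℕ) → ∑[ x ∈ xs ] (f x + g x) ≡ ∑ xs f + ∑ xs g
  ∑-distrib-+ []       f g = refl
  ∑-distrib-+ (x ∷ xs) f g =
    trans (cong (f x + g x +_) (∑-distrib-+ xs f g)) (interchange (f x) (g x) (∑ xs f) (∑ xs g))

  ∑-distribˡ-* : ∀ xs c (f : A → ℕ) → ∑[ x ∈ xs ] c * f x ≡ c * ∑ xs f
  ∑-distribˡ-* []       c f = sym (*-zeroʳ c)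
  ∑-distribˡ-* (x ∷ xs) c f = trans (cong (c * f x +_) (∑-distribˡ-* xs c f)) (sym (*-distribˡ-+ c (f x) _))

  ∑-distribʳ-* : ∀ xs c (f : A → ℕ) → ∑[ x ∈ xs ] f x * c ≡ ∑ xs f * c
  ∑-distribʳ-* xs c f = trans (∑-cong xs (λ x → *-comm (f x) c)) (trans (∑-distribˡ-* xs c f) (*-comm c _))

  ∑-mono-≤ : ∀ xs {f g : A → ℕ} → (∀ x → f x ≤ g x) → ∑ xs f ≤ ∑ xs g
  ∑-mono-≤ []       f≤g = z≤n
  ∑-mono-≤ (x ∷ xs) f≤g = +-mono-≤ (f≤g x) (∑-mono-≤ xs f≤g)

  ∑-↭ : ∀ {xs ys} (f : A → ℕ) → xs ↭ ys → ∑ xs f ≡ ∑ ys f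
  ∑-↭ f xs↭ys = sum-↭ (Perm.map⁺ f xs↭ys)

  module _ {P : A → Set} (P? : Decidable P) where

    ∑-filter : ∀ xs (f : A → ℕ) → ∑ (filter P? xs) f ≡ ∑[ x ∈ xs ] ⟦ does (P? x) ⟧ * f x
    ∑-filter []       f = refl
    ∑-filter (x ∷ xs) f with does (P? x)
    ... | true  = cong₂ _+_ (sym (+-identityʳ (f x))) (∑-filter xs f)
    ... | false = ∑-filter xs f

    length-filter : ∀ xs → length (filter P? xs) ≡ ∑[ x ∈ xs ] ⟦ does (P? x) ⟧
    length-filter []       = refl
    length-filter (x ∷ xs) with does (P? x)
    ... | true  = cong suc (length-filter xs)
    ... | false = length-filter xs

∑-map : {A B : Set} (h : A → B) (xs : List A) (f : B → ℕ) → ∑ (map h xs) f ≡ ∑ xs (f ∘ h)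
∑-map h xs f = cong sum (sym (List.map-∘ xs))

module _ {A B : Set} where

  ∑-concatMap : ∀ (g : A → List B) xs (f : B → ℕ) → ∑ (concatMap g xs) f ≡ ∑[ x ∈ xs ] ∑ (g x) f
  ∑-concatMap g []       f = refl
  ∑-concatMap g (x ∷ xs) f = trans (∑-++ (g x) (concatMap g xs) f) (cong (∑ (g x) f +_) (∑-concatMap g xs f))

  ∑-comm : ∀ xs ys (f : A → B → ℕ) → ∑[ x ∈ xs ] ∑[ y ∈ ys ] f x y ≡ ∑[ y ∈ ys ] ∑[ x ∈ xs ] f x y
  ∑-comm []       ys f = sym (∑-zero ys)
  ∑-comm (x ∷ xs) ys f = trans (cong (∑ ys (f x) +_) (∑-comm xs ys f)) (sym (∑-distrib-+ ys (f x) _))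

  ∑-cartesianProduct : ∀ xs ys (f : A × B → ℕ) → ∑ (cartesianProduct xs ys) f ≡ ∑[ x ∈ xs ] ∑[ y ∈ ys ] f (x , y)
  ∑-cartesianProduct []       ys f = refl
  ∑-cartesianProduct (x ∷ xs) ys f =
    trans (∑-++ (map (x ,_) ys) _ f) (cong₂ _+_ (∑-map (x ,_) ys f) (∑-cartesianProduct xs ys f))

eqF-refl : ∀ {k} (a : Fin k) → eqF a a ≡ true
eqF-refl a = dec-true (a Fin.≟ a) refl

eqF-≢ : ∀ {k} {a b : Fin k} → a ≢ b → eqF a b ≡ false
eqF-≢ = dec-false (_ Fin.≟ _)

eqF≡true⇒≡ : ∀ {k} {a b : Fin k} → eqF a b ≡ true → a ≡ b
eqF≡true⇒≡ {a = a} {b} e with a Fin.≟ b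
... | yes a≡b = a≡b

eqF-sym : ∀ {k} (a b : Fin k) → eqF a b ≡ eqF b a
eqF-sym a b = does-⇔ (mk⇔ sym sym) (a Fin.≟ b) (b Fin.≟ a)

eqF-punchIn : ∀ {k} (i : Fin (suc k)) (a b : Fin k) → eqF (punchIn i a) (punchIn i b) ≡ eqF a b
eqF-punchIn i a b = does-⇔ (mk⇔ (Fin.punchIn-injective i a b) (cong (punchIn i))) (punchIn i a Fin.≟ punchIn i b) (a Fin.≟ b)

∑-allFin-suc : ∀ n (f : Fin (suc n) → ℕ) → ∑ (allFin (suc n)) f ≡ f zero + ∑[ i ∈ allFin n ] f (suc i)
∑-allFin-suc n f =
  cong (f zero +_) (trans (cong sum (List.map-tabulate suc f)) (sym (cong sum (List.map-tabulate id (f ∘ suc)))))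

∑-allFin-punchIn : ∀ n (i : Fin (suc n)) (f : Fin (suc n) → ℕ) →
  ∑ (allFin (suc n)) f ≡ f i + ∑[ j ∈ allFin n ] f (punchIn i j)
∑-allFin-punchIn n       zero    f = ∑-allFin-suc n f
∑-allFin-punchIn (suc n) (suc i) f = begin
  ∑ (allFin (suc (suc n))) f
    ≡⟨ ∑-allFin-suc (suc n) f ⟩
  f zero + ∑[ j ∈ allFin (suc n) ] f (suc j)
    ≡⟨ cong (f zero +_) (∑-allFin-punchIn n i (f ∘ suc)) ⟩
  f zero + (f (suc i) + ∑[ j ∈ allFin n ] f (suc (punchIn i j)))
    ≡⟨ x∙yz≈y∙xz (f zero) (f (suc i)) _ ⟩
  f (suc i) + (f zero + ∑[ j ∈ allFin n ] f (suc (punchIn i j)))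
    ≡⟨ cong (f (suc i) +_) (∑-allFin-suc n (f ∘ punchIn (suc i))) ⟨
  f (suc i) + ∑[ j ∈ allFin (suc n) ] f (punchIn (suc i) j) ∎
  where open ≡-Reasoning

∑-allFin-const : ∀ n c → ∑[ i ∈ allFin n ] c ≡ n * c
∑-allFin-const zero    c = refl
∑-allFin-const (suc n) c = trans (∑-allFin-suc n (λ _ → c)) (cong (c +_) (∑-allFin-const n c))

∑-allFin-δ : ∀ {k} (h : Fin k) (g : Fin k → ℕ) → ∑[ b ∈ allFin k ] ⟦ eqF h b ⟧ * g b ≡ g h
∑-allFin-δ {suc k} zero g = begin
  ∑[ b ∈ allFin (suc k) ] ⟦ eqF zero b ⟧ * g b ≡⟨ ∑-allFin-suc k _ ⟩
  g zero + 0 + ∑[ b ∈ allFin k ] 0             ≡⟨ cong (g zero + 0 +_) (∑-zero (allFin k)) ⟩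
  g zero + 0 + 0                               ≡⟨ trans (+-identityʳ _) (+-identityʳ _) ⟩
  g zero                                       ∎
  where open ≡-Reasoning
∑-allFin-δ {suc k} (suc h) g = trans (∑-allFin-suc k (λ b → ⟦ eqF (suc h) b ⟧ * g b)) (∑-allFin-δ h (g ∘ suc))

count-≢ : ∀ {k} (y : Fin k) → ∑[ b ∈ allFin k ] ⟦ not (eqF b y) ⟧ ≡ k ∸ 1
count-≢ {suc k} y = begin
  ∑[ b ∈ allFin (suc k) ] ⟦ not (eqF b y) ⟧                      ≡⟨ ∑-allFin-punchIn k y _ ⟩
  ⟦ not (eqF y y) ⟧ + ∑[ b ∈ allFin k ] ⟦ not (eqF (punchIn y b) y) ⟧
    ≡⟨ cong₂ (λ e s → ⟦ not e ⟧ + s) (eqF-refl y)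
         (∑-cong (allFin k) (λ b → cong (⟦_⟧ ∘ not) (eqF-≢ (Fin.punchInᵢ≢i y b)))) ⟩
  ∑[ b ∈ allFin k ] 1                                              ≡⟨ ∑-allFin-const k 1 ⟩
  k * 1                                                            ≡⟨ *-identityʳ k ⟩
  k                                                                ∎
  where open ≡-Reasoning

count-≢₂ : ∀ {k} {y z : Fin k} → y ≢ z → ∑[ b ∈ allFin k ] ⟦ not (eqF b y) ⟧ * ⟦ not (eqF b z) ⟧ ≡ k ∸ 2
count-≢₂ {suc k} {y} {z} y≢z = begin
  ∑[ b ∈ allFin (suc k) ] ⟦ not (eqF b y) ⟧ * ⟦ not (eqF b z) ⟧
    ≡⟨ ∑-allFin-punchIn k y _ ⟩
  ⟦ not (eqF y y) ⟧ * ⟦ not (eqF y z) ⟧ + ∑[ b ∈ allFin k ] ⟦ not (eqF (punchIn y b) y) ⟧ * ⟦ not (eqF (punchIn y b) z) ⟧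
    ≡⟨ cong₂ _+_ (cong (λ e → ⟦ not e ⟧ * ⟦ not (eqF y z) ⟧) (eqF-refl y)) (∑-cong (allFin k) beside-y) ⟩
  ∑[ b ∈ allFin k ] ⟦ not (eqF b z′) ⟧
    ≡⟨ count-≢ z′ ⟩
  k ∸ 1
    ∎
  where
  open ≡-Reasoning
  z′ = punchOut y≢z
  beside-y : ∀ b → ⟦ not (eqF (punchIn y b) y) ⟧ * ⟦ not (eqF (punchIn y b) z) ⟧ ≡ ⟦ not (eqF b z′) ⟧
  beside-y b = trans (cong₂ (λ e e′ → ⟦ not e ⟧ * ⟦ not e′ ⟧) (eqF-≢ (Fin.punchInᵢ≢i y b))
                            (trans (cong (eqF (punchIn y b)) (sym (Fin.punchIn-punchOut y≢z))) (eqF-punchIn y b z′)))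
                     (*-identityˡ _)

count-≢₂-guarded : ∀ {k} (y z : Fin k) →
  ⟦ not (eqF y z) ⟧ * (∑[ b ∈ allFin k ] ⟦ not (eqF b y) ⟧ * ⟦ not (eqF b z) ⟧) ≡ ⟦ not (eqF y z) ⟧ * (k ∸ 2)
count-≢₂-guarded y z with y Fin.≟ z
... | yes _   = refl
... | no  y≢z = cong (1 *_) (count-≢₂ y≢z)

∑-allVecs-[] : ∀ k (f : Vec (Fin k) 0 → ℕ) → ∑ (allVecs k 0) f ≡ f []
∑-allVecs-[] k f = +-identityʳ (f [])

∑-allVecs-∷ : ∀ k n (f : Vec (Fin k) (suc n) → ℕ) →
  ∑ (allVecs k (suc n)) f ≡ ∑[ a ∈ allFin k ] ∑[ x ∈ allVecs k n ] f (a ∷ x)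
∑-allVecs-∷ k n f = trans (∑-concatMap (λ a → map (a ∷_) (allVecs k n)) (allFin k) f)
  (∑-cong (allFin k) (λ a → ∑-map (a ∷_) (allVecs k n) f))

∑-allVecs-insertAt : ∀ k n (i : Fin (suc n)) (f : Vec (Fin k) (suc n) → ℕ) →
  ∑ (allVecs k (suc n)) f ≡ ∑[ a ∈ allFin k ] ∑[ x ∈ allVecs k n ] f (insertAt x i a)
∑-allVecs-insertAt k n       zero    f = ∑-allVecs-∷ k n f
∑-allVecs-insertAt k (suc n) (suc i) f = begin
  ∑ (allVecs k (suc (suc n))) f
    ≡⟨ ∑-allVecs-∷ k (suc n) f ⟩
  ∑[ b ∈ allFin k ] ∑[ y ∈ allVecs k (suc n) ] f (b ∷ y)
    ≡⟨ ∑-cong (allFin k) (λ b → ∑-allVecs-insertAt k n i (f ∘ (b ∷_))) ⟩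
  ∑[ b ∈ allFin k ] ∑[ a ∈ allFin k ] ∑[ x ∈ allVecs k n ] f (b ∷ insertAt x i a)
    ≡⟨ ∑-comm (allFin k) (allFin k) _ ⟩
  ∑[ a ∈ allFin k ] ∑[ b ∈ allFin k ] ∑[ x ∈ allVecs k n ] f (b ∷ insertAt x i a)
    ≡⟨ ∑-cong (allFin k) (λ a → ∑-allVecs-∷ k n (λ y → f (insertAt y (suc i) a))) ⟨
  ∑[ a ∈ allFin k ] ∑[ y ∈ allVecs k (suc n) ] f (insertAt y (suc i) a) ∎
  where open ≡-Reasoning

∑-allVecs-extend : ∀ k n (i : Fin (suc n)) (f : Vec (Fin k) (suc n) → ℕ) →
  ∑ (allVecs k (suc n)) f ≡ ∑[ x ∈ allVecs k n ] ∑[ a ∈ allFin k ] f (insertAt x i a)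
∑-allVecs-extend k n i f = trans (∑-allVecs-insertAt k n i f) (∑-comm (allFin k) (allVecs k n) _)

∑-hamming≡0 : ∀ {k n} (c : Vec (Fin k) n) (g : Vec (Fin k) n → ℕ) →
  ∑[ c′ ∈ allVecs k n ] ⟦ hamming c c′ ≡ᵇ 0 ⟧ * g c′ ≡ g c
∑-hamming≡0 {k} []      g = trans (∑-allVecs-[] k (λ c′ → ⟦ hamming [] c′ ≡ᵇ 0 ⟧ * g c′)) (+-identityʳ (g []))
∑-hamming≡0 {k} {suc n} (a ∷ c) g = begin
  ∑[ c′ ∈ allVecs k (suc n) ] ⟦ hamming (a ∷ c) c′ ≡ᵇ 0 ⟧ * g c′  ≡⟨ ∑-allVecs-∷ k n _ ⟩
  ∑[ b ∈ allFin k ] ∑[ c′ ∈ allVecs k n ] head-equal b c′           ≡⟨ ∑-cong (allFin k) sum-over-tail ⟩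
  ∑[ b ∈ allFin k ] ⟦ eqF a b ⟧ * g (b ∷ c)                         ≡⟨ ∑-allFin-δ a (λ b → g (b ∷ c)) ⟩
  g (a ∷ c)                                                         ∎
  where
  open ≡-Reasoning
  head-equal : Fin k → Vec (Fin k) n → ℕ
  head-equal b c′ = ⟦ (if eqF a b then 0 else 1) + hamming c c′ ≡ᵇ 0 ⟧ * g (b ∷ c′)
  sum-over-tail : ∀ b → ∑[ c′ ∈ allVecs k n ] head-equal b c′ ≡ ⟦ eqF a b ⟧ * g (b ∷ c)
  sum-over-tail b with eqF a b
  ... | true  = trans (∑-hamming≡0 c (g ∘ (b ∷_))) (sym (+-identityʳ _))
  ... | false = ∑-zero (allVecs k n)

∑-hamming≡1 : ∀ {k n} (c : Vec (Fin k) n) (g : Vec (Fin k) n → ℕ) →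
  ∑[ c′ ∈ allVecs k n ] ⟦ hamming c c′ ≡ᵇ 1 ⟧ * g c′
    ≡ ∑[ v ∈ allFin n ] ∑[ a ∈ allFin k ] ⟦ not (eqF (lookup c v) a) ⟧ * g (c [ v ]≔ a)
∑-hamming≡1 {k} []      g = ∑-allVecs-[] k (λ c′ → ⟦ hamming [] c′ ≡ᵇ 1 ⟧ * g c′)
∑-hamming≡1 {k} {suc n} (a ∷ c) g = begin
  ∑[ c′ ∈ allVecs k (suc n) ] ⟦ hamming (a ∷ c) c′ ≡ᵇ 1 ⟧ * g c′
    ≡⟨ ∑-allVecs-∷ k n _ ⟩
  ∑[ b ∈ allFin k ] ∑[ c′ ∈ allVecs k n ] one-change b c′
    ≡⟨ ∑-cong (allFin k) sum-over-tail ⟩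
  ∑[ b ∈ allFin k ] (⟦ eqF a b ⟧ * tail-changes b + head-changes b) ≡⟨ ∑-distrib-+ (allFin k) _ head-changes ⟩
  ∑[ b ∈ allFin k ] ⟦ eqF a b ⟧ * tail-changes b + ∑ (allFin k) head-changes
    ≡⟨ cong (_+ ∑ (allFin k) head-changes) (∑-allFin-δ a tail-changes) ⟩
  tail-changes a + ∑ (allFin k) head-changes
    ≡⟨ cong (_+ ∑ (allFin k) head-changes) (∑-hamming≡1 c (g ∘ (a ∷_))) ⟩
  ∑[ v ∈ allFin n ] ∑[ b ∈ allFin k ] ⟦ not (eqF (lookup c v) b) ⟧ * g (a ∷ (c [ v ]≔ b)) + ∑ (allFin k) head-changes
    ≡⟨ +-comm _ (∑ (allFin k) head-changes) ⟩
  ∑ (allFin k) head-changes + ∑[ v ∈ allFin n ] ∑[ b ∈ allFin k ] ⟦ not (eqF (lookup c v) b) ⟧ * g (a ∷ (c [ v ]≔ b))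
    ≡⟨ ∑-allFin-suc n _ ⟨
  ∑[ v ∈ allFin (suc n) ] ∑[ b ∈ allFin k ] ⟦ not (eqF (lookup (a ∷ c) v) b) ⟧ * g ((a ∷ c) [ v ]≔ b) ∎
  where
  open ≡-Reasoning
  one-change : Fin k → Vec (Fin k) n → ℕ
  one-change b c′ = ⟦ (if eqF a b then 0 else 1) + hamming c c′ ≡ᵇ 1 ⟧ * g (b ∷ c′)
  tail-changes : Fin k → ℕ
  tail-changes b = ∑[ c′ ∈ allVecs k n ] ⟦ hamming c c′ ≡ᵇ 1 ⟧ * g (b ∷ c′)
  head-changes : Fin k → ℕ
  head-changes b = ⟦ not (eqF a b) ⟧ * g (b ∷ c)
  sum-over-tail : ∀ b → ∑[ c′ ∈ allVecs k n ] one-change b c′ ≡ ⟦ eqF a b ⟧ * tail-changes b + head-changes b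
  sum-over-tail b with eqF a b
  ... | true  = sym (trans (+-identityʳ _) (+-identityʳ _))
  ... | false = trans (∑-hamming≡0 c (g ∘ (b ∷_))) (sym (+-identityʳ _))

Proper : ∀ {n k} → Graph n → Vec (Fin k) n → Set
Proper G c = ∀ u v → Adj G u v → lookup c u ≢ lookup c v

allB-tabulate : ∀ {A : Set} {n} (p : A → Bool) (g : Fin n → A) →
  allB p (tabulate g) ≡ true ⇔ (∀ i → p (g i) ≡ true)
allB-tabulate {n = zero}  p g = mk⇔ (λ _ ()) (λ _ → refl)
allB-tabulate {n = suc n} p g = mk⇔
  (λ all → λ { zero → ∧-conicalˡ _ _ all ; (suc i) → to (allB-tabulate p (g ∘ suc)) (∧-conicalʳ _ _ all) i })
  (λ all → cong₂ _∧_ (all zero) (from (allB-tabulate p (g ∘ suc)) (all ∘ suc)))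

not-eqF⇔≢ : ∀ {k} (x y : Fin k) → not (eqF x y) ≡ true ⇔ x ≢ y
not-eqF⇔≢ x y with x Fin.≟ y
... | yes x≡y = mk⇔ (λ ()) (λ x≢y → ⊥-elim (x≢y x≡y))
... | no  x≢y = mk⇔ (λ _ → x≢y) (λ _ → refl)

nand-eqF : ∀ a {k} (x y : Fin k) → not (a ∧ eqF x y) ≡ true ⇔ (a ≡ true → x ≢ y)
nand-eqF false x y = mk⇔ (λ _ ()) (λ _ → refl)
nand-eqF true  x y = mk⇔ (λ ne _ → to (not-eqF⇔≢ x y) ne) (λ ne → from (not-eqF⇔≢ x y) (ne refl))

isProper⇔Proper : ∀ {n k} (G : Graph n) (c : Vec (Fin k) n) → isProper G c ≡ true ⇔ Proper G c
isProper⇔Proper G c = mk⇔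
  (λ ok u v → to (nand-eqF _ _ _) (to (allB-tabulate _ id) (to (allB-tabulate _ id) ok u) v))
  (λ proper → from (allB-tabulate _ id) (λ u → from (allB-tabulate _ id) (λ v → from (nand-eqF _ _ _) (proper u v))))

chromaticPolynomial : ∀ {n} → Graph n → ℕ → ℕ
chromaticPolynomial {n} G k = ∑[ c ∈ allVecs k n ] ⟦ isProper G c ⟧

recolorings : ∀ {n k} → Graph n → Fin n → Vec (Fin k) n → ℕ
recolorings {k = k} G v c =
  ⟦ isProper G c ⟧ * (∑[ a ∈ allFin k ] ⟦ not (eqF (lookup c v) a) ⟧ * ⟦ isProper G (c [ v ]≔ a) ⟧)

pairsAt : ∀ {n} → Graph n → ℕ → Fin n → ℕ
pairsAt {n} G k v = ∑[ c ∈ allVecs k n ] recolorings G v c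

∑-properColorings : ∀ {n} (G : Graph n) k (f : Vec (Fin k) n → ℕ) →
  ∑ (properColorings G k) f ≡ ∑[ c ∈ allVecs k n ] ⟦ isProper G c ⟧ * f c
∑-properColorings {n} G k f = trans (∑-filter (λ c → isProper G c Bool.≟ true) (allVecs k n) f)
  (∑-cong (allVecs k n) (λ c → cong (λ b → ⟦ b ⟧ * f c) (does-≟-true (isProper G c))))

-- The filter test does (h ℕ.≟ 1) of orderedAdjPairs computes to h ≡ᵇ 1.
orderedAdjPairs≡∑pairsAt : ∀ {n} (G : Graph n) k → orderedAdjPairs G k ≡ ∑[ v ∈ allFin n ] pairsAt G k v
orderedAdjPairs≡∑pairsAt {n} G k = begin
  orderedAdjPairs G k
    ≡⟨ length-filter (λ p → hamming (proj₁ p) (proj₂ p) ℕ.≟ 1) (cartesianProduct L L) ⟩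
  ∑[ p ∈ cartesianProduct L L ] ⟦ hamming (proj₁ p) (proj₂ p) ≡ᵇ 1 ⟧
    ≡⟨ ∑-cartesianProduct L L _ ⟩
  ∑[ c ∈ L ] ∑[ c′ ∈ L ] ⟦ hamming c c′ ≡ᵇ 1 ⟧
    ≡⟨ ∑-properColorings G k _ ⟩
  ∑[ c ∈ allVecs k n ] ⟦ isProper G c ⟧ * (∑[ c′ ∈ L ] ⟦ hamming c c′ ≡ᵇ 1 ⟧)
    ≡⟨ ∑-cong (allVecs k n) (λ c → trans (cong (⟦ isProper G c ⟧ *_) (neighbours c))
                                         (sym (∑-distribˡ-* (allFin n) ⟦ isProper G c ⟧ _))) ⟩
  ∑[ c ∈ allVecs k n ] ∑[ v ∈ allFin n ] recolorings G v c
    ≡⟨ ∑-comm (allVecs k n) (allFin n) _ ⟩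
  ∑[ v ∈ allFin n ] pairsAt G k v ∎
  where
  open ≡-Reasoning
  L = properColorings G k
  neighbours : ∀ c → ∑[ c′ ∈ L ] ⟦ hamming c c′ ≡ᵇ 1 ⟧
                   ≡ ∑[ v ∈ allFin n ] ∑[ a ∈ allFin k ] ⟦ not (eqF (lookup c v) a) ⟧ * ⟦ isProper G (c [ v ]≔ a) ⟧
  neighbours c = begin
    ∑[ c′ ∈ L ] ⟦ hamming c c′ ≡ᵇ 1 ⟧
      ≡⟨ ∑-properColorings G k _ ⟩
    ∑[ c′ ∈ allVecs k n ] ⟦ isProper G c′ ⟧ * ⟦ hamming c c′ ≡ᵇ 1 ⟧
      ≡⟨ ∑-cong (allVecs k n) (λ c′ → *-comm ⟦ isProper G c′ ⟧ _) ⟩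
    ∑[ c′ ∈ allVecs k n ] ⟦ hamming c c′ ≡ᵇ 1 ⟧ * ⟦ isProper G c′ ⟧
      ≡⟨ ∑-hamming≡1 c (λ c′ → ⟦ isProper G c′ ⟧) ⟩
    ∑[ v ∈ allFin n ] ∑[ a ∈ allFin k ] ⟦ not (eqF (lookup c v) a) ⟧ * ⟦ isProper G (c [ v ]≔ a) ⟧ ∎

-- Removing a leaf

Adj⇒≢ : ∀ {n} (G : Graph n) {u v} → Adj G u v → u ≢ v
Adj⇒≢ G {u} a refl = case trans (sym a) (irrefl G u) of λ ()

degree≡∑ : ∀ {n} (G : Graph n) v → degree G v ≡ ∑[ u ∈ allFin n ] ⟦ adj G v u ⟧
degree≡∑ {n} G v = trans (length-filter (λ u → adj G v u Bool.≟ true) (allFin n))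
  (∑-cong (allFin n) (λ u → cong ⟦_⟧ (does-≟-true (adj G v u))))

degree<n : ∀ {n} (G : Graph n) v → degree G v < n
degree<n {suc n} G v = s≤s (begin
  degree G v
    ≡⟨ degree≡∑ G v ⟩
  ∑[ u ∈ allFin (suc n) ] ⟦ adj G v u ⟧
    ≡⟨ ∑-allFin-punchIn n v _ ⟩
  ⟦ adj G v v ⟧ + ∑[ u ∈ allFin n ] ⟦ adj G v (punchIn v u) ⟧
    ≡⟨ cong (λ e → ⟦ e ⟧ + ∑[ u ∈ allFin n ] ⟦ adj G v (punchIn v u) ⟧) (irrefl G v) ⟩
  ∑[ u ∈ allFin n ] ⟦ adj G v (punchIn v u) ⟧
    ≤⟨ ∑-mono-≤ (allFin n) (λ u → ⟦⟧≤1 _) ⟩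
  ∑[ u ∈ allFin n ] 1
    ≡⟨ ∑-allFin-const n 1 ⟩
  n * 1
    ≡⟨ *-identityʳ n ⟩
  n ∎)
  where open ≤-Reasoning

removeVertex : ∀ {n} → Graph (suc n) → Fin (suc n) → Graph n
removeVertex G ℓ = record
  { adj    = λ u v → adj G (punchIn ℓ u) (punchIn ℓ v)
  ; symm   = λ u v → symm G (punchIn ℓ u) (punchIn ℓ v)
  ; irrefl = λ v → irrefl G (punchIn ℓ v)
  }

removeVertex-acyclic : ∀ {n} {G : Graph (suc n)} ℓ → Acyclic G → Acyclic (removeVertex G ℓ)
removeVertex-acyclic {G = G} ℓ acyclic cs cycle = acyclic (map (punchIn ℓ) cs) (mapped cs cycle)
  where
  mapped : ∀ cs → IsCycle (removeVertex G ℓ) cs → IsCycle G (map (punchIn ℓ) cs)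
  mapped (v ∷ vs) (long , unique , linked , w , last≡ , closing) =
    subst (λ l → 3 ≤ suc l) (sym (List.length-map (punchIn ℓ) vs)) long ,
    Unique.map⁺ (Fin.punchIn-injective ℓ _ _) unique ,
    Linked.map⁺ linked ,
    punchIn ℓ w , trans (List.last-map (punchIn ℓ) (v ∷ vs)) (cong (Maybe.map (punchIn ℓ)) last≡) , closing

-- The parent is named by its index in the graph without the leaf.
record Leaf {n} (G : Graph (suc n)) : Set where
  field
    leaf     : Fin (suc n)
    parent   : Fin n
    attached : Adj G leaf (punchIn leaf parent)
    only     : ∀ u → Adj G leaf u → u ≡ punchIn leaf parent

data PunchedIn {n} (i : Fin (suc n)) : Fin (suc n) → Set where
  at     : PunchedIn i i
  beside : ∀ j → PunchedIn i (punchIn i j)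

punchedIn : ∀ {n} (i j : Fin (suc n)) → PunchedIn i j
punchedIn i j with j Fin.≟ i
... | yes refl = at
... | no  j≢i  = subst (PunchedIn i) (Fin.punchIn-punchOut (j≢i ∘ sym)) (beside (punchOut (j≢i ∘ sym)))

[]≔-insertAt-punchIn : ∀ {A : Set} {n} (x : Vec A n) i j (a b : A) →
  insertAt x i b [ punchIn i j ]≔ a ≡ insertAt (x [ j ]≔ a) i b
[]≔-insertAt-punchIn x       zero    j       a b = refl
[]≔-insertAt-punchIn (y ∷ x) (suc i) zero    a b = refl
[]≔-insertAt-punchIn (y ∷ x) (suc i) (suc j) a b = cong (y ∷_) ([]≔-insertAt-punchIn x i j a b)

[]≔-insertAt : ∀ {A : Set} {n} (x : Vec A n) i (a b : A) → insertAt x i b [ i ]≔ a ≡ insertAt x i a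
[]≔-insertAt x       zero    a b = refl
[]≔-insertAt (y ∷ x) (suc i) a b = cong (y ∷_) ([]≔-insertAt x i a b)

module LeafRemoval {n} {G : Graph (suc n)} (L : Leaf G) where

  open Leaf L

  G′ : Graph n
  G′ = removeVertex G leaf

  adj-leaf : ∀ u → adj G leaf (punchIn leaf u) ≡ eqF parent u
  adj-leaf u = ⇔→≡ (mk⇔
    (λ a → dec-true (parent Fin.≟ u) (sym (Fin.punchIn-injective leaf u parent (only _ a))))
    (λ e → subst (λ w → Adj G leaf (punchIn leaf w)) (eqF≡true⇒≡ e) attached))

  degree-punchIn : ∀ v → degree G (punchIn leaf v) ≡ ⟦ eqF parent v ⟧ + degree G′ v
  degree-punchIn v = begin
    degree G (punchIn leaf v)
      ≡⟨ degree≡∑ G _ ⟩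
    ∑[ u ∈ allFin (suc n) ] ⟦ adj G (punchIn leaf v) u ⟧
      ≡⟨ ∑-allFin-punchIn n leaf _ ⟩
    ⟦ adj G (punchIn leaf v) leaf ⟧ + ∑[ u ∈ allFin n ] ⟦ adj G′ v u ⟧
      ≡⟨ cong₂ (λ e d → ⟦ e ⟧ + d) (trans (symm G _ leaf) (adj-leaf v)) (sym (degree≡∑ G′ v)) ⟩
    ⟦ eqF parent v ⟧ + degree G′ v ∎
    where open ≡-Reasoning

  degree-leaf : degree G leaf ≡ 1
  degree-leaf = begin
    degree G leaf
      ≡⟨ degree≡∑ G leaf ⟩
    ∑[ u ∈ allFin (suc n) ] ⟦ adj G leaf u ⟧
      ≡⟨ ∑-allFin-punchIn n leaf _ ⟩
    ⟦ adj G leaf leaf ⟧ + ∑[ u ∈ allFin n ] ⟦ adj G leaf (punchIn leaf u) ⟧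
      ≡⟨ cong₂ (λ e s → ⟦ e ⟧ + s) (irrefl G leaf)
           (∑-cong (allFin n) (λ u → trans (cong ⟦_⟧ (adj-leaf u)) (sym (*-identityʳ _)))) ⟩
    ∑[ u ∈ allFin n ] ⟦ eqF parent u ⟧ * 1
      ≡⟨ ∑-allFin-δ parent (λ _ → 1) ⟩
    1 ∎
    where open ≡-Reasoning

  degree-parent : degree G (punchIn leaf parent) ≡ suc (degree G′ parent)
  degree-parent = trans (degree-punchIn parent) (cong (λ e → ⟦ e ⟧ + degree G′ parent) (eqF-refl parent))

  degree-beside : ∀ v → v ≢ parent → degree G (punchIn leaf v) ≡ degree G′ v
  degree-beside v v≢parent = trans (degree-punchIn v) (cong (λ e → ⟦ e ⟧ + degree G′ v) (eqF-≢ (v≢parent ∘ sym)))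

  -- A walk through the leaf enters and leaves it via the parent, so that detour can be cut out.
  shortcut : ∀ {u v} → Walk G u v → ∀ {a b} → u ≡ punchIn leaf a → v ≡ punchIn leaf b → Walk G′ a b
  shortcut [] {a} {b} refl v≡ = subst (Walk G′ a) (Fin.punchIn-injective leaf a b v≡) []
  shortcut (_∷_ {w = w} e rest) u≡ v≡ with punchedIn leaf w
  ... | beside c = subst (λ z → Adj G z (punchIn leaf c)) u≡ e ∷ shortcut rest refl v≡
  ... | at with rest
  ...   | []         = ⊥-elim (Fin.punchInᵢ≢i leaf _ (sym v≡))
  ...   | e′ ∷ rest′ = shortcut rest′ (trans (only _ e′) (trans (sym (only _ (trans (symm G leaf _) e))) u≡)) v≡

  removeLeaf-connected : Connected G → Connected G′
  removeLeaf-connected connected a b = shortcut (connected (punchIn leaf a) (punchIn leaf b)) refl refl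

  module _ {k} (x : Vec (Fin k) n) (b : Fin k) where

    private
      c = insertAt x leaf b
      c-leaf : lookup c leaf ≡ b
      c-leaf = Vec.insertAt-lookup x leaf b
      c-punchIn : ∀ u → lookup c (punchIn leaf u) ≡ lookup x u
      c-punchIn = Vec.insertAt-punchIn x leaf b

    Proper-insertAt : Proper G c ⇔ (b ≢ lookup x parent × Proper G′ x)
    Proper-insertAt = mk⇔
      (λ proper → (λ b≡y → proper leaf (punchIn leaf parent) attached (trans c-leaf (trans b≡y (sym (c-punchIn parent)))))
                , (λ u v a eq → proper (punchIn leaf u) (punchIn leaf v) a (trans (c-punchIn u) (trans eq (sym (c-punchIn v))))))
      (λ (b≢y , proper′) → extended b≢y proper′)
      where
      color-at-parent : ∀ v → Adj G leaf v → lookup c v ≡ lookup x parent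
      color-at-parent v a = trans (cong (lookup c) (only v a)) (c-punchIn parent)
      extended : b ≢ lookup x parent → Proper G′ x → Proper G c
      extended b≢y proper′ u v a eq with punchedIn leaf u | punchedIn leaf v
      ... | at        | _         = b≢y (trans (sym c-leaf) (trans eq (color-at-parent v a)))
      ... | beside u′ | at        = b≢y (trans (sym c-leaf) (trans (sym eq) (color-at-parent _ (trans (symm G leaf _) a))))
      ... | beside u′ | beside v′ = proper′ u′ v′ a (trans (sym (c-punchIn u′)) (trans eq (c-punchIn v′)))

    isProper-insertAt : isProper G c ≡ not (eqF b (lookup x parent)) ∧ isProper G′ x
    isProper-insertAt = ⇔→≡ (mk⇔
      (λ ok → let (b≢y , proper′) = to Proper-insertAt (to (isProper⇔Proper G c) ok)
              in cong₂ _∧_ (from (not-eqF⇔≢ _ _) b≢y) (from (isProper⇔Proper G′ x) proper′))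
      (λ ok → from (isProper⇔Proper G c) (from Proper-insertAt
        (to (not-eqF⇔≢ _ _) (∧-conicalˡ _ _ ok) , to (isProper⇔Proper G′ x) (∧-conicalʳ _ _ ok)))))

  module _ (k : ℕ) where

    chromaticPolynomial-removeLeaf : chromaticPolynomial G k ≡ (k ∸ 1) * chromaticPolynomial G′ k
    chromaticPolynomial-removeLeaf = begin
      chromaticPolynomial G k                                                    ≡⟨ ∑-allVecs-extend k n leaf _ ⟩
      ∑[ x ∈ allVecs k n ] ∑[ b ∈ allFin k ] ⟦ isProper G (insertAt x leaf b) ⟧  ≡⟨ ∑-cong (allVecs k n) extensions ⟩
      ∑[ x ∈ allVecs k n ] (k ∸ 1) * ⟦ isProper G′ x ⟧                           ≡⟨ ∑-distribˡ-* (allVecs k n) (k ∸ 1) _ ⟩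
      (k ∸ 1) * chromaticPolynomial G′ k                                         ∎
      where
      open ≡-Reasoning
      extensions : ∀ x → ∑[ b ∈ allFin k ] ⟦ isProper G (insertAt x leaf b) ⟧ ≡ (k ∸ 1) * ⟦ isProper G′ x ⟧
      extensions x = begin
        ∑[ b ∈ allFin k ] ⟦ isProper G (insertAt x leaf b) ⟧
          ≡⟨ ∑-cong (allFin k) (λ b → trans (cong ⟦_⟧ (isProper-insertAt x b))
                                            (⟦∧⟧ (not (eqF b (lookup x parent))) (isProper G′ x))) ⟩
        ∑[ b ∈ allFin k ] ⟦ not (eqF b (lookup x parent)) ⟧ * ⟦ isProper G′ x ⟧
          ≡⟨ ∑-distribʳ-* (allFin k) _ _ ⟩
        (∑[ b ∈ allFin k ] ⟦ not (eqF b (lookup x parent)) ⟧) * ⟦ isProper G′ x ⟧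
          ≡⟨ cong (_* ⟦ isProper G′ x ⟧) (count-≢ (lookup x parent)) ⟩
        (k ∸ 1) * ⟦ isProper G′ x ⟧ ∎

    module _ (x : Vec (Fin k) n) where

      private
        y = lookup x parent
        P = isProper G′ x

      recolorings-beside : ∀ v → v ≢ parent → ∀ b →
        recolorings G (punchIn leaf v) (insertAt x leaf b) ≡ ⟦ not (eqF b y) ⟧ * recolorings G′ v x
      recolorings-beside v v≢parent b = begin
        recolorings G (punchIn leaf v) (insertAt x leaf b)
          ≡⟨ cong₂ (λ s t → ⟦ s ⟧ * t) (isProper-insertAt x b) (∑-cong (allFin k) recolor) ⟩
        ⟦ not (eqF b y) ∧ P ⟧ * (∑[ a ∈ allFin k ] ⟦ not (eqF (lookup x v) a) ⟧ * ⟦ not (eqF b y) ∧ Q a ⟧)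
          ≡⟨ guard (not (eqF b y)) ⟩
        ⟦ not (eqF b y) ⟧ * recolorings G′ v x
          ∎
        where
        open ≡-Reasoning
        Q : Fin k → Bool
        Q a = isProper G′ (x [ v ]≔ a)
        recolor : ∀ a → ⟦ not (eqF (lookup (insertAt x leaf b) (punchIn leaf v)) a) ⟧
                           * ⟦ isProper G (insertAt x leaf b [ punchIn leaf v ]≔ a) ⟧
                       ≡ ⟦ not (eqF (lookup x v) a) ⟧ * ⟦ not (eqF b y) ∧ Q a ⟧
        recolor a = cong₂ (λ z c → ⟦ not (eqF z a) ⟧ * ⟦ c ⟧) (Vec.insertAt-punchIn x leaf b v) (begin
          isProper G (insertAt x leaf b [ punchIn leaf v ]≔ a) ≡⟨ cong (isProper G) ([]≔-insertAt-punchIn x leaf v a b) ⟩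
          isProper G (insertAt (x [ v ]≔ a) leaf b)
            ≡⟨ isProper-insertAt (x [ v ]≔ a) b ⟩
          not (eqF b (lookup (x [ v ]≔ a) parent)) ∧ Q a
            ≡⟨ cong (λ z → not (eqF b z) ∧ Q a) (Vec.lookup∘update′ (v≢parent ∘ sym) x a) ⟩
          not (eqF b y) ∧ Q a ∎)
        guard : ∀ g → ⟦ g ∧ P ⟧ * (∑[ a ∈ allFin k ] ⟦ not (eqF (lookup x v) a) ⟧ * ⟦ g ∧ Q a ⟧)
                    ≡ ⟦ g ⟧ * recolorings G′ v x
        guard true  = sym (+-identityʳ _)
        guard false = refl

      private
        moved : Fin k → ℕ
        moved a = ⟦ not (eqF y a) ⟧
        Q : Fin k → Bool
        Q a = isProper G′ (x [ parent ]≔ a)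

      recolorings-parent : ∀ b → recolorings G (punchIn leaf parent) (insertAt x leaf b)
                                   ≡ ⟦ not (eqF b y) ⟧ * ⟦ P ⟧ * (∑[ a ∈ allFin k ] moved a * (⟦ not (eqF b a) ⟧ * ⟦ Q a ⟧))
      recolorings-parent b = cong₂ _*_ (trans (cong ⟦_⟧ (isProper-insertAt x b)) (⟦∧⟧ (not (eqF b y)) P)) (∑-cong (allFin k) recolor)
        where
        open ≡-Reasoning
        recolor : ∀ a → ⟦ not (eqF (lookup (insertAt x leaf b) (punchIn leaf parent)) a) ⟧
                           * ⟦ isProper G (insertAt x leaf b [ punchIn leaf parent ]≔ a) ⟧
                       ≡ moved a * (⟦ not (eqF b a) ⟧ * ⟦ Q a ⟧)
        recolor a = cong₂ (λ z c → ⟦ not (eqF z a) ⟧ * c) (Vec.insertAt-punchIn x leaf b parent) (begin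
          ⟦ isProper G (insertAt x leaf b [ punchIn leaf parent ]≔ a) ⟧
            ≡⟨ cong (⟦_⟧ ∘ isProper G) ([]≔-insertAt-punchIn x leaf parent a b) ⟩
          ⟦ isProper G (insertAt (x [ parent ]≔ a) leaf b) ⟧
            ≡⟨ cong ⟦_⟧ (isProper-insertAt (x [ parent ]≔ a) b) ⟩
          ⟦ not (eqF b (lookup (x [ parent ]≔ a) parent)) ∧ Q a ⟧
            ≡⟨ cong (λ z → ⟦ not (eqF b z) ∧ Q a ⟧) (Vec.lookup∘update parent x a) ⟩
          ⟦ not (eqF b a) ∧ Q a ⟧
            ≡⟨ ⟦∧⟧ (not (eqF b a)) (Q a) ⟩
          ⟦ not (eqF b a) ⟧ * ⟦ Q a ⟧ ∎)

      ∑-recolorings-parent : ∑[ b ∈ allFin k ] recolorings G (punchIn leaf parent) (insertAt x leaf b)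
                               ≡ (k ∸ 2) * recolorings G′ parent x
      ∑-recolorings-parent = begin
        ∑[ b ∈ allFin k ] recolorings G (punchIn leaf parent) (insertAt x leaf b)
          ≡⟨ ∑-cong (allFin k) (λ b → trans (recolorings-parent b)
                                            (sym (∑-distribˡ-* (allFin k) (⟦ not (eqF b y) ⟧ * ⟦ P ⟧) _))) ⟩
        ∑[ b ∈ allFin k ] ∑[ a ∈ allFin k ] ⟦ not (eqF b y) ⟧ * ⟦ P ⟧ * (moved a * (⟦ not (eqF b a) ⟧ * ⟦ Q a ⟧))
          ≡⟨ ∑-cong (allFin k) (λ b → ∑-cong (allFin k) (λ a →
               regroup ⟦ not (eqF b y) ⟧ ⟦ P ⟧ (moved a) ⟦ not (eqF b a) ⟧ ⟦ Q a ⟧)) ⟩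
        ∑[ b ∈ allFin k ] ∑[ a ∈ allFin k ] ⟦ P ⟧ * ⟦ Q a ⟧ * (moved a * (⟦ not (eqF b y) ⟧ * ⟦ not (eqF b a) ⟧))
          ≡⟨ ∑-comm (allFin k) (allFin k) _ ⟩
        ∑[ a ∈ allFin k ] ∑[ b ∈ allFin k ] ⟦ P ⟧ * ⟦ Q a ⟧ * (moved a * (⟦ not (eqF b y) ⟧ * ⟦ not (eqF b a) ⟧))
          ≡⟨ ∑-cong (allFin k) (λ a → trans (∑-distribˡ-* (allFin k) (⟦ P ⟧ * ⟦ Q a ⟧) _)
                                            (cong (⟦ P ⟧ * ⟦ Q a ⟧ *_) (∑-distribˡ-* (allFin k) (moved a) _))) ⟩
        ∑[ a ∈ allFin k ] ⟦ P ⟧ * ⟦ Q a ⟧ * (moved a * (∑[ b ∈ allFin k ] ⟦ not (eqF b y) ⟧ * ⟦ not (eqF b a) ⟧))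
          ≡⟨ ∑-cong (allFin k) (λ a → cong (⟦ P ⟧ * ⟦ Q a ⟧ *_) (count-≢₂-guarded y a)) ⟩
        ∑[ a ∈ allFin k ] ⟦ P ⟧ * ⟦ Q a ⟧ * (moved a * (k ∸ 2))
          ≡⟨ ∑-cong (allFin k) (λ a → rearrange ⟦ P ⟧ ⟦ Q a ⟧ (moved a) (k ∸ 2)) ⟩
        ∑[ a ∈ allFin k ] (k ∸ 2) * (⟦ P ⟧ * (moved a * ⟦ Q a ⟧))
          ≡⟨ trans (∑-distribˡ-* (allFin k) (k ∸ 2) _) (cong ((k ∸ 2) *_) (∑-distribˡ-* (allFin k) ⟦ P ⟧ _)) ⟩
        (k ∸ 2) * recolorings G′ parent x
          ∎
        where
        open ≡-Reasoning
        regroup : ∀ s p e t q → s * p * (e * (t * q)) ≡ p * q * (e * (s * t))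
        regroup = solve-∀
        rearrange : ∀ p q e c → p * q * (e * c) ≡ c * (p * (e * q))
        rearrange = solve-∀

      recolorings-leaf : ∀ b → recolorings G leaf (insertAt x leaf b)
                             ≡ ⟦ not (eqF b y) ⟧ * ⟦ P ⟧ * (∑[ a ∈ allFin k ] ⟦ not (eqF a b) ⟧ * (⟦ not (eqF a y) ⟧ * ⟦ P ⟧))
      recolorings-leaf b = cong₂ _*_ (trans (cong ⟦_⟧ (isProper-insertAt x b)) (⟦∧⟧ (not (eqF b y)) P)) (∑-cong (allFin k) recolor)
        where
        recolor : ∀ a → ⟦ not (eqF (lookup (insertAt x leaf b) leaf) a) ⟧ * ⟦ isProper G (insertAt x leaf b [ leaf ]≔ a) ⟧
                       ≡ ⟦ not (eqF a b) ⟧ * (⟦ not (eqF a y) ⟧ * ⟦ P ⟧)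
        recolor a = cong₂ (λ e c → ⟦ not e ⟧ * c)
          (trans (cong (λ z → eqF z a) (Vec.insertAt-lookup x leaf b)) (eqF-sym b a))
          (trans (cong (⟦_⟧ ∘ isProper G) ([]≔-insertAt x leaf a b))
                 (trans (cong ⟦_⟧ (isProper-insertAt x a)) (⟦∧⟧ (not (eqF a y)) P)))

      ∑-recolorings-leaf : ∑[ b ∈ allFin k ] recolorings G leaf (insertAt x leaf b) ≡ (k ∸ 1) * (k ∸ 2) * ⟦ P ⟧
      ∑-recolorings-leaf = begin
        ∑[ b ∈ allFin k ] recolorings G leaf (insertAt x leaf b)
          ≡⟨ ∑-cong (allFin k) (λ b → trans (recolorings-leaf b) (cong (⟦ not (eqF b y) ⟧ * ⟦ P ⟧ *_) (avoid b))) ⟩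
        ∑[ b ∈ allFin k ] ⟦ not (eqF b y) ⟧ * ⟦ P ⟧ * ((∑[ a ∈ allFin k ] ⟦ not (eqF a b) ⟧ * ⟦ not (eqF a y) ⟧) * ⟦ P ⟧)
          ≡⟨ ∑-cong (allFin k) (λ b → trans (regroup ⟦ not (eqF b y) ⟧ ⟦ P ⟧ _)
                                            (cong₂ _*_ (⟦⟧-idem P) (count-≢₂-guarded b y))) ⟩
        ∑[ b ∈ allFin k ] ⟦ P ⟧ * (⟦ not (eqF b y) ⟧ * (k ∸ 2))
          ≡⟨ trans (∑-distribˡ-* (allFin k) ⟦ P ⟧ _) (cong (⟦ P ⟧ *_) (∑-distribʳ-* (allFin k) (k ∸ 2) _)) ⟩
        ⟦ P ⟧ * ((∑[ b ∈ allFin k ] ⟦ not (eqF b y) ⟧) * (k ∸ 2))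
          ≡⟨ cong (λ s → ⟦ P ⟧ * (s * (k ∸ 2))) (count-≢ y) ⟩
        ⟦ P ⟧ * ((k ∸ 1) * (k ∸ 2))
          ≡⟨ *-comm ⟦ P ⟧ _ ⟩
        (k ∸ 1) * (k ∸ 2) * ⟦ P ⟧
          ∎
        where
        open ≡-Reasoning
        avoid : ∀ b → ∑[ a ∈ allFin k ] ⟦ not (eqF a b) ⟧ * (⟦ not (eqF a y) ⟧ * ⟦ P ⟧)
                    ≡ (∑[ a ∈ allFin k ] ⟦ not (eqF a b) ⟧ * ⟦ not (eqF a y) ⟧) * ⟦ P ⟧
        avoid b = trans (∑-cong (allFin k) (λ a → sym (*-assoc ⟦ not (eqF a b) ⟧ ⟦ not (eqF a y) ⟧ ⟦ P ⟧)))
                        (∑-distribʳ-* (allFin k) ⟦ P ⟧ _)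
        regroup : ∀ s p t → s * p * (t * p) ≡ p * p * (s * t)
        regroup = solve-∀

    pairsAt-beside : ∀ v → v ≢ parent → pairsAt G k (punchIn leaf v) ≡ (k ∸ 1) * pairsAt G′ k v
    pairsAt-beside v v≢parent = begin
      pairsAt G k (punchIn leaf v)
        ≡⟨ ∑-allVecs-extend k n leaf _ ⟩
      ∑[ x ∈ allVecs k n ] ∑[ b ∈ allFin k ] recolorings G (punchIn leaf v) (insertAt x leaf b)
        ≡⟨ ∑-cong (allVecs k n) extensions ⟩
      ∑[ x ∈ allVecs k n ] (k ∸ 1) * recolorings G′ v x
        ≡⟨ ∑-distribˡ-* (allVecs k n) (k ∸ 1) _ ⟩
      (k ∸ 1) * pairsAt G′ k v ∎
      where
      open ≡-Reasoning
      extensions : ∀ x → ∑[ b ∈ allFin k ] recolorings G (punchIn leaf v) (insertAt x leaf b) ≡ (k ∸ 1) * recolorings G′ v x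
      extensions x = begin
        ∑[ b ∈ allFin k ] recolorings G (punchIn leaf v) (insertAt x leaf b)
          ≡⟨ ∑-cong (allFin k) (recolorings-beside x v v≢parent) ⟩
        ∑[ b ∈ allFin k ] ⟦ not (eqF b (lookup x parent)) ⟧ * recolorings G′ v x
          ≡⟨ ∑-distribʳ-* (allFin k) _ _ ⟩
        (∑[ b ∈ allFin k ] ⟦ not (eqF b (lookup x parent)) ⟧) * recolorings G′ v x
          ≡⟨ cong (_* recolorings G′ v x) (count-≢ (lookup x parent)) ⟩
        (k ∸ 1) * recolorings G′ v x ∎

    pairsAt-parent : pairsAt G k (punchIn leaf parent) ≡ (k ∸ 2) * pairsAt G′ k parent
    pairsAt-parent = trans (∑-allVecs-extend k n leaf _)
      (trans (∑-cong (allVecs k n) ∑-recolorings-parent) (∑-distribˡ-* (allVecs k n) (k ∸ 2) _))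

    pairsAt-leaf : pairsAt G k leaf ≡ (k ∸ 1) * (k ∸ 2) * chromaticPolynomial G′ k
    pairsAt-leaf = trans (∑-allVecs-extend k n leaf _)
      (trans (∑-cong (allVecs k n) ∑-recolorings-leaf) (∑-distribˡ-* (allVecs k n) ((k ∸ 1) * (k ∸ 2)) _))

-- Graphs built by attaching leaves

data Prunable : ∀ {m} → Graph (suc m) → Set where
  single : (G : Graph 1) → Prunable G
  prune  : ∀ {m} {G : Graph (suc (suc m))} (L : Leaf G) → Prunable (removeVertex G (Leaf.leaf L)) → Prunable G

isProper-single : ∀ {k} (G : Graph 1) (c : Vec (Fin k) 1) → isProper G c ≡ true
isProper-single G c = from (isProper⇔Proper G c) λ { zero zero a _ → Adj⇒≢ G a refl }

chromaticPolynomial-prunable : ∀ {m} {G : Graph (suc m)} → Prunable G → ∀ k → chromaticPolynomial G k ≡ k * (k ∸ 1) ^ m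
chromaticPolynomial-prunable (single G) k = begin
  chromaticPolynomial G k
    ≡⟨ ∑-allVecs-∷ k 0 _ ⟩
  ∑[ a ∈ allFin k ] (⟦ isProper G (a ∷ []) ⟧ + 0)
    ≡⟨ ∑-cong (allFin k) (λ a → cong (λ e → ⟦ e ⟧ + 0) (isProper-single G (a ∷ []))) ⟩
  ∑[ a ∈ allFin k ] 1
    ≡⟨ ∑-allFin-const k 1 ⟩
  k * 1 ∎
  where open ≡-Reasoning
chromaticPolynomial-prunable {suc m} {G} (prune L T) k = begin
  chromaticPolynomial G k                         ≡⟨ chromaticPolynomial-removeLeaf k ⟩
  (k ∸ 1) * chromaticPolynomial G′ k              ≡⟨ cong ((k ∸ 1) *_) (chromaticPolynomial-prunable T k) ⟩
  (k ∸ 1) * (k * (k ∸ 1) ^ m)                     ≡⟨ x*[y*z]≡y*[x*z] (k ∸ 1) k _ ⟩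
  k * (k ∸ 1) ^ suc m                             ∎
  where
  open ≡-Reasoning
  open LeafRemoval L

degreeTerm : ℕ → ℕ → ℕ → ℕ
degreeTerm k m d = (k ∸ 1) ^ (m ∸ d) * (k ∸ 2) ^ d

pairsAt-single : ∀ (G : Graph 1) k → pairsAt G k zero ≡ k * (k ∸ 1)
pairsAt-single G k = begin
  pairsAt G k zero                                      ≡⟨ ∑-allVecs-∷ k 0 _ ⟩
  ∑[ b ∈ allFin k ] (recolorings G zero (b ∷ []) + 0)   ≡⟨ ∑-cong (allFin k) recolor ⟩
  ∑[ b ∈ allFin k ] (k ∸ 1)                             ≡⟨ ∑-allFin-const k (k ∸ 1) ⟩
  k * (k ∸ 1)                                           ∎
  where
  open ≡-Reasoning
  recolor : ∀ b → recolorings G zero (b ∷ []) + 0 ≡ k ∸ 1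
  recolor b = begin
    recolorings G zero (b ∷ []) + 0
      ≡⟨ cong₂ (λ s t → ⟦ s ⟧ * t + 0) (isProper-single G (b ∷ []))
           (∑-cong (allFin k) (λ a → cong₂ (λ e s → ⟦ not e ⟧ * ⟦ s ⟧) (eqF-sym b a) (isProper-single G (a ∷ [])))) ⟩
    1 * (∑[ a ∈ allFin k ] ⟦ not (eqF a b) ⟧ * 1) + 0    ≡⟨ trans (+-identityʳ _) (*-identityˡ _) ⟩
    ∑[ a ∈ allFin k ] ⟦ not (eqF a b) ⟧ * 1              ≡⟨ ∑-cong (allFin k) (λ a → *-identityʳ _) ⟩
    ∑[ a ∈ allFin k ] ⟦ not (eqF a b) ⟧                  ≡⟨ count-≢ b ⟩
    k ∸ 1                                                ∎

pairsAt-prunable : ∀ {m} {G : Graph (suc m)} → Prunable G → ∀ k v →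
  pairsAt G k v ≡ k * (k ∸ 1) * degreeTerm k m (degree G v)
pairsAt-prunable (single G) k zero = begin
  pairsAt G k zero                               ≡⟨ pairsAt-single G k ⟩
  k * (k ∸ 1)                                    ≡⟨ *-identityʳ _ ⟨
  k * (k ∸ 1) * degreeTerm k 0 0                 ≡⟨ cong (λ d → k * (k ∸ 1) * degreeTerm k 0 d) (n<1⇒n≡0 (degree<n G zero)) ⟨
  k * (k ∸ 1) * degreeTerm k 0 (degree G zero)   ∎
  where open ≡-Reasoning
pairsAt-prunable {suc m} {G} (prune L T) k v = by-position (punchedIn leaf v)
  where
  open ≡-Reasoning
  open Leaf L
  open LeafRemoval L
  by-position : ∀ {v} → PunchedIn leaf v → pairsAt G k v ≡ k * (k ∸ 1) * degreeTerm k (suc m) (degree G v)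
  by-position at = begin
    pairsAt G k leaf
      ≡⟨ pairsAt-leaf k ⟩
    (k ∸ 1) * (k ∸ 2) * chromaticPolynomial G′ k
      ≡⟨ cong ((k ∸ 1) * (k ∸ 2) *_) (chromaticPolynomial-prunable T k) ⟩
    (k ∸ 1) * (k ∸ 2) * (k * (k ∸ 1) ^ m)
      ≡⟨ rearrange (k ∸ 1) (k ∸ 2) k _ ⟩
    k * (k ∸ 1) * degreeTerm k (suc m) 1
      ≡⟨ cong (λ d → k * (k ∸ 1) * degreeTerm k (suc m) d) degree-leaf ⟨
    k * (k ∸ 1) * degreeTerm k (suc m) (degree G leaf) ∎
    where
    rearrange : ∀ a b k z → a * b * (k * z) ≡ k * a * (z * (b * 1))
    rearrange = solve-∀
  by-position (beside v) with v Fin.≟ parent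
  ... | yes refl = begin
    pairsAt G k (punchIn leaf parent)
      ≡⟨ pairsAt-parent k ⟩
    (k ∸ 2) * pairsAt G′ k parent
      ≡⟨ cong ((k ∸ 2) *_) (pairsAt-prunable T k parent) ⟩
    (k ∸ 2) * (k * (k ∸ 1) * degreeTerm k m d)
      ≡⟨ rearrange (k ∸ 2) k (k ∸ 1) ((k ∸ 1) ^ (m ∸ d)) ((k ∸ 2) ^ d) ⟩
    k * (k ∸ 1) * degreeTerm k (suc m) (suc d)
      ≡⟨ cong (λ e → k * (k ∸ 1) * degreeTerm k (suc m) e) degree-parent ⟨
    k * (k ∸ 1) * degreeTerm k (suc m) (degree G (punchIn leaf parent)) ∎
    where
    d = degree G′ parent
    rearrange : ∀ c k a y w → c * (k * a * (y * w)) ≡ k * a * (y * (c * w))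
    rearrange = solve-∀
  ... | no v≢parent = begin
    pairsAt G k (punchIn leaf v)
      ≡⟨ pairsAt-beside k v v≢parent ⟩
    (k ∸ 1) * pairsAt G′ k v
      ≡⟨ cong ((k ∸ 1) *_) (pairsAt-prunable T k v) ⟩
    (k ∸ 1) * (k * (k ∸ 1) * degreeTerm k m d)
      ≡⟨ rearrange (k ∸ 1) k ((k ∸ 1) ^ (m ∸ d)) ((k ∸ 2) ^ d) ⟩
    k * (k ∸ 1) * ((k ∸ 1) ^ suc (m ∸ d) * (k ∸ 2) ^ d)
      ≡⟨ cong (λ e → k * (k ∸ 1) * ((k ∸ 1) ^ e * (k ∸ 2) ^ d)) (+-∸-assoc 1 d≤m) ⟨
    k * (k ∸ 1) * degreeTerm k (suc m) d
      ≡⟨ cong (λ e → k * (k ∸ 1) * degreeTerm k (suc m) e) (degree-beside v v≢parent) ⟨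
    k * (k ∸ 1) * degreeTerm k (suc m) (degree G (punchIn leaf v)) ∎
    where
    d = degree G′ v
    d≤m : d ≤ m
    d≤m = s≤s⁻¹ (degree<n G′ v)
    rearrange : ∀ a k y w → a * (k * a * (y * w)) ≡ k * a * (a * y * w)
    rearrange = solve-∀

degreeSum : ℕ → ℕ → List ℕ → ℕ
degreeSum k m ds = ∑[ d ∈ ds ] degreeTerm k m d

C2*2≡*∸1 : ∀ k → (k C 2) * 2 ≡ k * (k ∸ 1)
C2*2≡*∸1 zero    = refl
C2*2≡*∸1 (suc k) = begin
  (suc k C 2) * 2        ≡⟨ cong (_* 2) (nCk+nC[k+1]≡[n+1]C[k+1] k 1) ⟨
  (k C 1 + k C 2) * 2  ≡⟨ cong (λ c → (c + k C 2) * 2) (nC1≡n k) ⟩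
  (k + k C 2) * 2      ≡⟨ *-distribʳ-+ 2 k (k C 2) ⟩
  k * 2 + (k C 2) * 2    ≡⟨ cong (k * 2 +_) (C2*2≡*∸1 k) ⟩
  k * 2 + k * (k ∸ 1)  ≡⟨ pred-step k ⟩
  suc k * k            ∎
  where
  open ≡-Reasoning
  pred-step : ∀ k → k * 2 + k * (k ∸ 1) ≡ suc k * k
  pred-step zero    = refl
  pred-step (suc j) = identity j
    where
    identity : ∀ j → suc j * 2 + suc j * j ≡ suc (suc j) * suc j
    identity = solve-∀

chromaticPairs-prunable : ∀ {m} {G : Graph (suc m)} → Prunable G → ∀ k →
  chromaticPairs G k ≡ (k C 2) * degreeSum k m (degreeList G)
chromaticPairs-prunable {m} {G} T k = trans (cong (_/ 2) ordered) (m*n/n≡m _ 2)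
  where
  open ≡-Reasoning
  ordered : orderedAdjPairs G k ≡ (k C 2) * degreeSum k m (degreeList G) * 2
  ordered = begin
    orderedAdjPairs G k
      ≡⟨ orderedAdjPairs≡∑pairsAt G k ⟩
    ∑[ v ∈ allFin (suc m) ] pairsAt G k v
      ≡⟨ ∑-cong (allFin (suc m)) (pairsAt-prunable T k) ⟩
    ∑[ v ∈ allFin (suc m) ] k * (k ∸ 1) * degreeTerm k m (degree G v)
      ≡⟨ ∑-distribˡ-* (allFin (suc m)) (k * (k ∸ 1)) _ ⟩
    k * (k ∸ 1) * (∑[ v ∈ allFin (suc m) ] degreeTerm k m (degree G v))
      ≡⟨ cong₂ _*_ (C2*2≡*∸1 k) (∑-map (degree G) (allFin (suc m)) _) ⟨
    (k C 2) * 2 * degreeSum k m (degreeList G)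
      ≡⟨ x*y*z≡x*z*y (k C 2) 2 _ ⟩
    (k C 2) * degreeSum k m (degreeList G) * 2 ∎

-- Every tree is built by attaching leaves

module _ {n : ℕ} where

  punchOuts : (x : Fin (suc n)) {xs : List (Fin (suc n))} → All (x ≢_) xs → List (Fin n)
  punchOuts x []           = []
  punchOuts x (x≢y ∷ x≢ys) = punchOut x≢y ∷ punchOuts x x≢ys

  length-punchOuts : ∀ x {xs} (x≢xs : All (x ≢_) xs) → length (punchOuts x x≢xs) ≡ length xs
  length-punchOuts x []           = refl
  length-punchOuts x (_ ∷ x≢ys)   = cong suc (length-punchOuts x x≢ys)

  punchOuts-≢ : ∀ x {y ys} (x≢y : x ≢ y) (x≢ys : All (x ≢_) ys) → All (y ≢_) ys → All (punchOut x≢y ≢_) (punchOuts x x≢ys)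
  punchOuts-≢ x x≢y []            []            = []
  punchOuts-≢ x x≢y (x≢z ∷ x≢zs) (y≢z ∷ y≢zs) = (y≢z ∘ Fin.punchOut-injective x≢y x≢z) ∷ punchOuts-≢ x x≢y x≢zs y≢zs

  Unique-punchOuts : ∀ x {xs} (x≢xs : All (x ≢_) xs) → Unique xs → Unique (punchOuts x x≢xs)
  Unique-punchOuts x []           []             = []
  Unique-punchOuts x (x≢y ∷ x≢ys) (y≢ys ∷ unique) = punchOuts-≢ x x≢y x≢ys y≢ys ∷ Unique-punchOuts x x≢ys unique

Unique⇒length≤ : ∀ {n} (xs : List (Fin n)) → Unique xs → length xs ≤ n
Unique⇒length≤         []       _                = z≤n
Unique⇒length≤ {suc n} (x ∷ xs) (x≢xs ∷ unique) = s≤s (begin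
  length xs                     ≡⟨ length-punchOuts x x≢xs ⟨
  length (punchOuts x x≢xs)     ≤⟨ Unique⇒length≤ (punchOuts x x≢xs) (Unique-punchOuts x x≢xs unique) ⟩
  n                             ∎)
  where open ≤-Reasoning

module _ {A : Set} where

  prefixTo : ∀ {u : A} {xs} → u ∈ xs → List A
  prefixTo (here  {x} _) = x ∷ []
  prefixTo (there {x} q) = x ∷ prefixTo q

  All-prefixTo : ∀ {P : A → Set} {u xs} (q : u ∈ xs) → All P xs → All P (prefixTo q)
  All-prefixTo (here  _) (px ∷ _)   = px ∷ []
  All-prefixTo (there q) (px ∷ pxs) = px ∷ All-prefixTo q pxs

  Unique-prefixTo : ∀ {u xs} (q : u ∈ xs) → Unique xs → Unique (prefixTo q)
  Unique-prefixTo (here  _) (_ ∷ _)           = [] ∷ []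
  Unique-prefixTo (there q) (x≢xs ∷ unique) = All-prefixTo q x≢xs ∷ Unique-prefixTo q unique

  Linked-prefixTo : ∀ {R : A → A → Set} {a u xs} (q : u ∈ xs) → Linked R (a ∷ xs) → Linked R (a ∷ prefixTo q)
  Linked-prefixTo (here  _) (r ∷ _)      = r ∷ [-]
  Linked-prefixTo (there q) (r ∷ linked) = r ∷ Linked-prefixTo q linked

  last-∷-prefixTo : ∀ (a : A) {u xs} (q : u ∈ xs) → last (a ∷ prefixTo q) ≡ just u
  last-∷-prefixTo a (here refl) = refl
  last-∷-prefixTo a (there q)   = last-∷-prefixTo _ q

  3≤2+length-prefixTo : ∀ {u xs} (q : u ∈ xs) → 3 ≤ suc (suc (length (prefixTo q)))
  3≤2+length-prefixTo (here  _) = ≤-refl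
  3≤2+length-prefixTo (there _) = s≤s (s≤s (s≤s z≤n))

module Paths {n} (G : Graph (suc n)) where

  open import Data.List.Membership.DecPropositional (Fin._≟_ {suc n}) using (_∈?_)

  record Path : Set where
    constructor path
    field
      head next : Fin (suc n)
      rest      : List (Fin (suc n))
      unique    : Unique (head ∷ next ∷ rest)
      linked    : Linked (Adj G) (head ∷ next ∷ rest)

  open Path

  Maximal : Path → Set
  Maximal P = ∀ u → Adj G (head P) u → u ∈ next P ∷ rest P

  -- A path has at most suc n vertices, so the bound rules out running out of fuel while the path can grow.
  maximise : ∀ fuel (P : Path) → suc n ≤ 2 + length (rest P) + fuel → Σ Path Maximal
  maximise fuel P@(path h p t unique linked) bound
    with Fin.any? (λ u → (adj G h u Bool.≟ true) ×-dec ¬? (u ∈? h ∷ p ∷ t))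
  ... | no stuck = P , maximal
    where
    maximal : Maximal P
    maximal u a with u ∈? h ∷ p ∷ t
    ... | yes (here refl) = ⊥-elim (Adj⇒≢ G a refl)
    ... | yes (there u∈)  = u∈
    ... | no  u∉          = ⊥-elim (stuck (u , a , u∉))
  ... | yes (u , a , u∉) = grow fuel bound
    where
    unique′ : Unique (u ∷ h ∷ p ∷ t)
    unique′ = All.¬Any⇒All¬ (h ∷ p ∷ t) u∉ ∷ unique
    grow : ∀ fuel → suc n ≤ 2 + length t + fuel → Σ Path Maximal
    grow zero        bound = ⊥-elim (<-irrefl refl (≤-trans (Unique⇒length≤ _ unique′) (≤-trans bound (≤-reflexive (+-identityʳ _)))))
    grow (suc fuel′) bound =
      maximise fuel′ (path u h (p ∷ t) unique′ (trans (symm G u h) a ∷ linked)) (≤-trans bound (≤-reflexive (+-suc _ fuel′)))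

  closing-cycle : ∀ P {u} → Adj G (head P) u → (q : u ∈ rest P) → IsCycle G (head P ∷ next P ∷ prefixTo q)
  closing-cycle (path h p t ((h≢p ∷ h≢t) ∷ (p≢t ∷ unique)) (r ∷ linked)) {u} a q =
    3≤2+length-prefixTo q ,
    ((h≢p ∷ All-prefixTo q h≢t) ∷ (All-prefixTo q p≢t ∷ Unique-prefixTo q unique)) ,
    (r ∷ Linked-prefixTo q linked) ,
    (u , last-∷-prefixTo p q , trans (symm G u h) a)

  -- Any other neighbour of the end of a maximal path would close a cycle.
  leaf-at-head : Acyclic G → Σ Path Maximal → Leaf G
  leaf-at-head acyclic (P@(path h p t _ (h~p ∷ _)) , maximal) = record
    { leaf     = h
    ; parent   = punchOut h≢p
    ; attached = subst (Adj G h) (sym (Fin.punchIn-punchOut h≢p)) h~p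
    ; only     = λ u a → trans (only-p u a) (sym (Fin.punchIn-punchOut h≢p))
    }
    where
    h≢p = Adj⇒≢ G h~p
    only-p : ∀ u → Adj G h u → u ≡ p
    only-p u a with maximal u a
    ... | here  u≡p = u≡p
    ... | there q   = ⊥-elim (acyclic _ (closing-cycle P a q))

leaf-of-tree : ∀ {n} (G : Graph (suc (suc n))) → Connected G → Acyclic G → Leaf G
leaf-of-tree {n} G connected acyclic with connected zero (suc zero)
... | _∷_ {w = w} a _ = leaf-at-head acyclic
  (maximise (2 + n) (path w zero [] (((Adj⇒≢ G a ∘ sym) ∷ []) ∷ ([] ∷ [])) (trans (symm G w zero) a ∷ [-])) (m≤n+m _ 2))
  where open Paths G

tree⇒prunable : ∀ {m} (G : Graph (suc m)) → Connected G → Acyclic G → Prunable G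
tree⇒prunable {zero}  G _         _       = single G
tree⇒prunable {suc m} G connected acyclic =
  prune L (tree⇒prunable (removeVertex G leaf) (removeLeaf-connected connected) (removeVertex-acyclic leaf acyclic))
  where
  L = leaf-of-tree G connected acyclic
  open Leaf L
  open LeafRemoval L

-- The degree sum determines the degree sequence

zeros : List ℕ → ℕ
zeros []           = 0
zeros (zero  ∷ ds) = suc (zeros ds)
zeros (suc _ ∷ ds) = zeros ds

lowered : List ℕ → List ℕ
lowered []           = []
lowered (zero  ∷ ds) = lowered ds
lowered (suc d ∷ ds) = d ∷ lowered ds

↭-zeros-lowered : ∀ ds → ds ↭ replicate (zeros ds) 0 ++ map suc (lowered ds)
↭-zeros-lowered []           = ↭-refl
↭-zeros-lowered (zero  ∷ ds) = prep 0 (↭-zeros-lowered ds)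
↭-zeros-lowered (suc d ∷ ds) =
  ↭-trans (prep (suc d) (↭-zeros-lowered ds)) (↭-sym (Perm.shift (suc d) (replicate (zeros ds) 0) (map suc (lowered ds))))

↭-zeros-lowered⁺ : ∀ {ds es} → zeros ds ≡ zeros es → lowered ds ↭ lowered es → ds ↭ es
↭-zeros-lowered⁺ {ds} {es} same-zeros lowered↭ = begin
  ds                                            ↭⟨ ↭-zeros-lowered ds ⟩
  replicate (zeros ds) 0 ++ map suc (lowered ds) ↭⟨ Perm.++⁺ˡ (replicate (zeros ds) 0) (Perm.map⁺ suc lowered↭) ⟩
  replicate (zeros ds) 0 ++ map suc (lowered es) ≡⟨ cong (λ z → replicate z 0 ++ map suc (lowered es)) same-zeros ⟩
  replicate (zeros es) 0 ++ map suc (lowered es) ↭⟨ ↭-zeros-lowered es ⟨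
  es                                            ∎
  where open PermutationReasoning

zeros≤length : ∀ ds → zeros ds ≤ length ds
zeros≤length []           = z≤n
zeros≤length (zero  ∷ ds) = s≤s (zeros≤length ds)
zeros≤length (suc _ ∷ ds) = m≤n⇒m≤1+n (zeros≤length ds)

lowered-≤ : ∀ {m ds} → All (_≤ suc m) ds → All (_≤ m) (lowered ds)
lowered-≤ {ds = []}         []                = []
lowered-≤ {ds = zero  ∷ ds} (_ ∷ ds≤)         = lowered-≤ ds≤
lowered-≤ {ds = suc d ∷ ds} (s≤s d≤m ∷ ds≤)   = d≤m ∷ lowered-≤ ds≤

lowered-≤0 : ∀ {ds} → All (_≤ 0) ds → lowered ds ≡ []
lowered-≤0 []          = refl
lowered-≤0 (z≤n ∷ ds≤) = lowered-≤0 ds≤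

degreeSum-≤0 : ∀ k {ds} → All (_≤ 0) ds → degreeSum k 0 ds ≡ zeros ds
degreeSum-≤0 k []          = refl
degreeSum-≤0 k (z≤n ∷ ds≤) = cong suc (degreeSum-≤0 k ds≤)

-- With k = 2 + x the truncated subtractions in degreeTerm compute away.
degreeSum-split : ∀ x m ds → degreeSum (2 + x) (suc m) ds ≡ zeros ds * suc x ^ suc m + x * degreeSum (2 + x) m (lowered ds)
degreeSum-split x m []           = sym (*-zeroʳ x)
degreeSum-split x m (zero  ∷ ds) = begin
  suc x ^ suc m * 1 + degreeSum (2 + x) (suc m) ds
    ≡⟨ cong₂ _+_ (*-identityʳ (suc x ^ suc m)) (degreeSum-split x m ds) ⟩
  suc x ^ suc m + (zeros ds * suc x ^ suc m + x * degreeSum (2 + x) m (lowered ds))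
    ≡⟨ +-assoc (suc x ^ suc m) _ _ ⟨
  suc x ^ suc m + zeros ds * suc x ^ suc m + x * degreeSum (2 + x) m (lowered ds) ∎
  where open ≡-Reasoning
degreeSum-split x m (suc d ∷ ds) = trans (cong (suc x ^ (m ∸ d) * (x * x ^ d) +_) (degreeSum-split x m ds))
  (rearrange (suc x ^ (m ∸ d)) x (x ^ d) (zeros ds * suc x ^ suc m) (degreeSum (2 + x) m (lowered ds)))
  where
  rearrange : ∀ a x b c r → a * (x * b) + (c + x * r) ≡ c + x * (a * b + r)
  rearrange = solve-∀

suc^≡1+* : ∀ x j → ∃ λ q → suc x ^ j ≡ 1 + x * q
suc^≡1+* x zero    = 0 , cong suc (sym (*-zeroʳ x))
suc^≡1+* x (suc j) with suc^≡1+* x j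
... | q , eq = 1 + q * suc x , trans (cong (suc x *_) eq) (expand x q)
  where
  expand : ∀ x q → suc x * (1 + x * q) ≡ 1 + x * (1 + q * suc x)
  expand = solve-∀

degreeSum≡zeros+* : ∀ x m ds → ∃ λ s → degreeSum (2 + x) (suc m) ds ≡ zeros ds + s * x
degreeSum≡zeros+* x m ds with suc^≡1+* x (suc m)
... | q , eq = zeros ds * q + degreeSum (2 + x) m (lowered ds) ,
  trans (degreeSum-split x m ds) (trans (cong (λ z → zeros ds * z + x * degreeSum (2 + x) m (lowered ds)) eq)
    (rearrange (zeros ds) x q (degreeSum (2 + x) m (lowered ds))))
  where
  rearrange : ∀ a x q r → a * (1 + x * q) + x * r ≡ a + (a * q + r) * x
  rearrange = solve-∀

residue-unique : ∀ {a b X} s t → a < X → b < X → a + s * X ≡ b + t * X → a ≡ b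
residue-unique {a} {b} {suc X} s t a<X b<X eq = begin
  a                         ≡⟨ m<n⇒m%n≡m a<X ⟨
  a % suc X                 ≡⟨ [m+kn]%n≡m%n a s (suc X) ⟨
  (a + s * suc X) % suc X   ≡⟨ cong (_% suc X) eq ⟩
  (b + t * suc X) % suc X   ≡⟨ [m+kn]%n≡m%n b t (suc X) ⟩
  b % suc X                 ≡⟨ m<n⇒m%n≡m b<X ⟩
  b                         ∎
  where open ≡-Reasoning

-- Modulo a large x + 1 the sum counts the zero entries; removing them leaves a factor x + 1 to cancel.
degreeSum-injective : ∀ m {ds es} → All (_≤ m) ds → All (_≤ m) es →
  (∀ x → degreeSum (3 + x) m ds ≡ degreeSum (3 + x) m es) → ds ↭ es
degreeSum-injective zero ds≤ es≤ same = ↭-zeros-lowered⁺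
  (trans (sym (degreeSum-≤0 3 ds≤)) (trans (same 0) (degreeSum-≤0 3 es≤)))
  (subst₂ _↭_ (sym (lowered-≤0 ds≤)) (sym (lowered-≤0 es≤)) ↭-refl)
degreeSum-injective (suc m) {ds} {es} ds≤ es≤ same =
  ↭-zeros-lowered⁺ same-zeros (degreeSum-injective m (lowered-≤ ds≤) (lowered-≤ es≤) same-lowered)
  where
  X = suc (length ds + length es)
  same-zeros : zeros ds ≡ zeros es
  same-zeros with degreeSum≡zeros+* X m ds | degreeSum≡zeros+* X m es
  ... | s , eq₁ | t , eq₂ = residue-unique s t
    (s≤s (≤-trans (zeros≤length ds) (m≤m+n _ _))) (s≤s (≤-trans (zeros≤length es) (m≤n+m _ _)))
    (trans (sym eq₁) (trans (same (length ds + length es)) eq₂))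
  same-lowered : ∀ x → degreeSum (3 + x) m (lowered ds) ≡ degreeSum (3 + x) m (lowered es)
  same-lowered x = *-cancelˡ-≡ _ _ (suc x) (+-cancelˡ-≡ (zeros ds * (2 + x) ^ suc m) _ _ (begin
    zeros ds * (2 + x) ^ suc m + suc x * degreeSum (3 + x) m (lowered ds)
      ≡⟨ degreeSum-split (suc x) m ds ⟨
    degreeSum (3 + x) (suc m) ds
      ≡⟨ same x ⟩
    degreeSum (3 + x) (suc m) es
      ≡⟨ degreeSum-split (suc x) m es ⟩
    zeros es * (2 + x) ^ suc m + suc x * degreeSum (3 + x) m (lowered es)
      ≡⟨ cong (λ z → z * (2 + x) ^ suc m + _) same-zeros ⟨
    zeros ds * (2 + x) ^ suc m + suc x * degreeSum (3 + x) m (lowered es) ∎))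
    where open ≡-Reasoning

^-∸-split : ∀ x {m d} → d ≤ m → x ^ (m ∸ d) * x ^ d ≡ x ^ m
^-∸-split x {m} {d} d≤m = trans (sym (^-distribˡ-+-* x (m ∸ d) d)) (cong (x ^_) (m∸n+n≡m d≤m))

degreeSum-lower : ∀ x m {d ds} → d ≤ m → x ^ m ≤ degreeSum (2 + x) m (d ∷ ds)
degreeSum-lower x m {d} {ds} d≤m = begin
  x ^ m                          ≡⟨ ^-∸-split x d≤m ⟨
  x ^ (m ∸ d) * x ^ d            ≤⟨ *-monoˡ-≤ (x ^ d) (^-monoˡ-≤ (m ∸ d) (n≤1+n x)) ⟩
  suc x ^ (m ∸ d) * x ^ d        ≤⟨ m≤m+n _ (degreeSum (2 + x) m ds) ⟩
  degreeSum (2 + x) m (d ∷ ds)   ∎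
  where open ≤-Reasoning

degreeSum-upper : ∀ x m {ds} → All (_≤ m) ds → degreeSum (2 + x) m ds ≤ length ds * suc x ^ m
degreeSum-upper x m []                    = z≤n
degreeSum-upper x m {d ∷ ds} (d≤m ∷ ds≤m) = +-mono-≤ term≤ (degreeSum-upper x m ds≤m)
  where
  term≤ : suc x ^ (m ∸ d) * x ^ d ≤ suc x ^ m
  term≤ = ≤-trans (*-monoʳ-≤ (suc x ^ (m ∸ d)) (^-monoˡ-≤ d (n≤1+n x))) (≤-reflexive (^-∸-split (suc x) d≤m))

suc^≤2^*^ : ∀ y m → suc (suc y) ^ m ≤ 2 ^ m * suc y ^ m
suc^≤2^*^ y zero    = ≤-refl
suc^≤2^*^ y (suc m) = begin
  suc (suc y) * suc (suc y) ^ m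
    ≤⟨ *-mono-≤ (≤-trans (m≤m+n (suc (suc y)) y) (≤-reflexive (sym (double y)))) (suc^≤2^*^ y m) ⟩
  2 * suc y * (2 ^ m * suc y ^ m)
    ≡⟨ [m*n]*[o*p]≡[m*o]*[n*p] 2 (suc y) (2 ^ m) _ ⟩
  2 * 2 ^ m * (suc y * suc y ^ m) ∎
  where
  open ≤-Reasoning
  double : ∀ y → 2 * suc y ≡ suc (suc y) + y
  double = solve-∀

-- The left sum has degree m₁ in x while the right one has degree at least m₂.
degreeSum-growth : ∀ {m₁ m₂ ds d es} → m₁ < m₂ → length ds ≡ suc m₁ → All (_≤ m₁) ds → d ≤ m₂ →
  ∃ λ x → degreeSum (2 + x) m₁ ds < degreeSum (2 + x) m₂ (d ∷ es)
degreeSum-growth {m₁} {m₂} {ds} {d} {es} m₁<m₂ length≡ ds≤ d≤ = X , (begin-strict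
  degreeSum (2 + X) m₁ ds          ≤⟨ degreeSum-upper X m₁ ds≤ ⟩
  length ds * suc X ^ m₁           ≡⟨ cong (_* suc X ^ m₁) length≡ ⟩
  suc m₁ * suc X ^ m₁              ≤⟨ *-monoʳ-≤ (suc m₁) (suc^≤2^*^ c m₁) ⟩
  suc m₁ * (2 ^ m₁ * X ^ m₁)       ≡⟨ *-assoc (suc m₁) (2 ^ m₁) (X ^ m₁) ⟨
  c * X ^ m₁                       <⟨ *-monoˡ-< (X ^ m₁) {{m^n≢0 X m₁}} (n<1+n c) ⟩
  X * X ^ m₁                       ≤⟨ ^-monoʳ-≤ X m₁<m₂ ⟩
  X ^ m₂                           ≤⟨ degreeSum-lower X m₂ {ds = es} d≤ ⟩
  degreeSum (2 + X) m₂ (d ∷ es)    ∎)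
  where
  open ≤-Reasoning
  c = suc m₁ * 2 ^ m₁
  X = suc c

degreeSum-≉ : ∀ {m₁ m₂ ds es} → m₁ < m₂ →
  length ds ≡ suc m₁ → length es ≡ suc m₂ → All (_≤ m₁) ds → All (_≤ m₂) es →
  ¬ (∀ x → degreeSum (2 + x) m₁ ds ≡ degreeSum (2 + x) m₂ es)
degreeSum-≉ {es = _ ∷ es} m₁<m₂ length₁ _ ds≤ (d≤ ∷ _) same with degreeSum-growth {es = es} m₁<m₂ length₁ ds≤ d≤
... | x , smaller = <-irrefl (same x) smaller

degreeSum-≗⇒≡ : ∀ {m₁ m₂ ds es} → length ds ≡ suc m₁ → length es ≡ suc m₂ → All (_≤ m₁) ds → All (_≤ m₂) es →
  (∀ x → degreeSum (2 + x) m₁ ds ≡ degreeSum (2 + x) m₂ es) → m₁ ≡ m₂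
degreeSum-≗⇒≡ {m₁} {m₂} length₁ length₂ ds≤ es≤ same with <-cmp m₁ m₂
... | tri< m₁<m₂ _ _ = ⊥-elim (degreeSum-≉ m₁<m₂ length₁ length₂ ds≤ es≤ same)
... | tri≈ _ m₁≡m₂ _ = m₁≡m₂
... | tri> _ _ m₂<m₁ = ⊥-elim (degreeSum-≉ m₂<m₁ length₂ length₁ es≤ ds≤ (sym ∘ same))

C2*-cancel : ∀ x {a b} → ((2 + x) C 2) * a ≡ ((2 + x) C 2) * b → a ≡ b
C2*-cancel x {a} {b} eq = *-cancelˡ-≡ a b ((2 + x) * suc x) (begin
  (2 + x) * suc x * a     ≡⟨ cong (_* a) (C2*2≡*∸1 (2 + x)) ⟨
  ((2 + x) C 2) * 2 * a     ≡⟨ x*y*z≡x*z*y ((2 + x) C 2) 2 a ⟩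
  ((2 + x) C 2) * a * 2     ≡⟨ cong (_* 2) eq ⟩
  ((2 + x) C 2) * b * 2     ≡⟨ x*y*z≡x*z*y ((2 + x) C 2) b 2 ⟩
  ((2 + x) C 2) * 2 * b     ≡⟨ cong (_* b) (C2*2≡*∸1 (2 + x)) ⟩
  (2 + x) * suc x * b     ∎)
  where open ≡-Reasoning

length-degreeList : ∀ {n} (G : Graph n) → length (degreeList G) ≡ n
length-degreeList {n} G = trans (List.length-map (degree G) (allFin n)) (List.length-tabulate id)

degreeList-≤ : ∀ {m} (G : Graph (suc m)) → All (_≤ m) (degreeList G)
degreeList-≤ G = All.map⁺ (All.tabulate⁺ (λ v → s≤s⁻¹ (degree<n G v)))

theorem5p1 : ∀ {n₁ n₂} (T₁ : Graph n₁) (T₂ : Graph n₂) → IsTree T₁ → IsTree T₂ →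
    ((∀ (k : ℕ) → chromaticPairs T₁ k ≡ chromaticPairs T₂ k) ⇔ (degreeList T₁ ↭ degreeList T₂))
theorem5p1 {zero}           _  _  (() , _) _
theorem5p1 {suc _} {zero}   _  _  _        (() , _)
theorem5p1 {suc m₁} {suc m₂} T₁ T₂ (_ , connected₁ , acyclic₁) (_ , connected₂ , acyclic₂) = mk⇔ same-degrees same-pairs
  where
  pairs₁ = chromaticPairs-prunable (tree⇒prunable T₁ connected₁ acyclic₁)
  pairs₂ = chromaticPairs-prunable (tree⇒prunable T₂ connected₂ acyclic₂)

  same-degreeSums : (∀ k → chromaticPairs T₁ k ≡ chromaticPairs T₂ k) →
    ∀ x → degreeSum (2 + x) m₁ (degreeList T₁) ≡ degreeSum (2 + x) m₂ (degreeList T₂)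
  same-degreeSums same x = C2*-cancel x (trans (sym (pairs₁ (2 + x))) (trans (same (2 + x)) (pairs₂ (2 + x))))

  same-degrees : (∀ k → chromaticPairs T₁ k ≡ chromaticPairs T₂ k) → degreeList T₁ ↭ degreeList T₂
  same-degrees same
    with degreeSum-≗⇒≡ (length-degreeList T₁) (length-degreeList T₂) (degreeList-≤ T₁) (degreeList-≤ T₂) (same-degreeSums same)
  ... | refl = degreeSum-injective m₁ (degreeList-≤ T₁) (degreeList-≤ T₂) (same-degreeSums same ∘ suc)

  same-pairs : degreeList T₁ ↭ degreeList T₂ → ∀ k → chromaticPairs T₁ k ≡ chromaticPairs T₂ k
  same-pairs D₁↭D₂ k with suc-injective (trans (sym (length-degreeList T₁)) (trans (Perm.↭-length D₁↭D₂) (length-degreeList T₂)))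
  ... | refl = trans (pairs₁ k) (trans (cong ((k C 2) *_) (∑-↭ (degreeTerm k m₁) D₁↭D₂)) (sym (pairs₂ k)))
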